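{- Let $r,n$ be positive integers, $0\le l\le n$, and let $\epsilon=(1,\dots,1,0,\dots,0)\in\mathbb{Z}_r^n$ with exactly $l$ entries equal to $1$ (if $l>0$ assume $r\ge2$), so $\operatorname{col}(\epsilon)=l$. Then \[\sum_{(v,k)\in L_\epsilon} m(v,k)=\frac{\sum_{(\gamma,\pi)\in G_\epsilon} q^{\operatorname{maj}(\gamma,\pi)}t^{\operatorname{des}(\gamma,\pi)}u^{\operatorname{col}(\epsilon)}}{\prod_{j=0}^n(1-q^jt)}.\]
   Context: The wreath product $\mathbb{Z}_r\wr\mathfrak{S}_n$ is the set of pairs $(\epsilon,\pi)$ with $\epsilon\in[0,r-1]^n$ and $\pi\in\mathfrak{S}_n$, written in window notation $[\pi(1)^{\epsilon_1}\cdots\pi(n)^{\epsilon_n}]$. Set $\pi(0)=0$ and $\epsilon_0=0$. On colored letters $a^c$ the Biagioli–Zeng order is: $a^c<b^d$ iff either ($c=d=0$ and $a<b$), or ($c,d>0$ and $a>b$), or ($c>0$ and $d=0$). The descent set is $\operatorname{Des}(\epsilon,\pi)=\{i\in[0,n-1]\mid \pi(i)^{\epsilon_i}>\pi(i+1)^{\epsilon_{i+1}}\}$, $\operatorname{des}=|\operatorname{Des}|$, $\operatorname{maj}(\epsilon,\pi)=\sum_{i\in\operatorname{Des}(\epsilon,\pi)}i$, and $\operatorname{col}(\epsilon)=\sum_{i=1}^n\epsilon_i$; $\operatorname{supp}(\epsilon)=\{i\mid\epsilon_i>0\}$. For $\epsilon\in\mathbb{Z}_r^n$, $G_\epsilon=\{((\epsilon_{\pi(1)},\dots,\epsilon_{\pi(n)}),\pi)\mid\pi\in\mathfrak{S}_n\}$,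 i.e. the colored permutations $[\pi(1)^{\epsilon_{\pi(1)}}\cdots\pi(n)^{\epsilon_{\pi(n)}}]$ in which letter $a$ always carries color $\epsilon_a$. For integers $k\ge 0$ and $0\le j\le kr$ define $m'(j,k)=q^j$ if $0\le j\le k$, and $m'(j,k)=q^{(j-1)\bmod k}\,u^{\lfloor (j-1)/k\rfloor}$ if $k<j\le kr$, with $(j-1)\bmod k\in[0,k-1]$. Set $m(v,k)=\big(\prod_{i=1}^n m'(v_i,k)\big)t^k$. For $\epsilon\in\mathbb{Z}_r^n$, $L_\epsilon=\{(v,k)\in\mathbb{Z}^n\times\mathbb{Z}_{\ge0}\mid k\epsilon_i\le v_i\le k(\epsilon_i+1)\text{ for all }i,\text{ with }k\epsilon_i<v_i\text{ whenever }\epsilon_i>0\}$ (the lattice points of the cone over the partially open cube $F_\epsilon=(\epsilon+[0,1]^n)\setminus\bigcup_{i\in\operatorname{supp}(\epsilon)}\{x_i=\epsilon_i\}$). -}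

module Defs where

open import Data.Nat using (ℕ; zero; suc; _+_; _*_; _∸_; _≤ᵇ_; _<ᵇ_; _≡ᵇ_; _/_; _%_)
open import Data.Bool using (Bool; true; false; _∧_; _∨_; not; if_then_else_)
open import Data.Fin using (Fin; toℕ)
open import Data.Vec using (Vec; []; _∷_; lookup; toList; zip)
open import Data.List using (List; []; _∷_; map; concatMap; length; upTo; allFin)
open import Data.Nat.ListAction using (sum)
open import Data.Product using (_×_; _,_; proj₁; proj₂)
open import Relation.Binary.PropositionalEquality using (_≡_)

count : {A : Set} → (A → Bool) → List A → ℕ
count p []       = 0
count p (x ∷ xs) = if p x then suc (count p xs) else count p xs

allVecs : {A : Set} → List A → (n : ℕ) → List (Vec A n)
allVecs xs zero    = [] ∷ []
allVecs xs (suc n) = concatMap (λ x → map (x ∷_) (allVecs xs n)) xs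

allᵇ : {A : Set} → (A → Bool) → List A → Bool
allᵇ p []       = true
allᵇ p (x ∷ xs) = p x ∧ allᵇ p xs

sumTo : ℕ → (ℕ → ℕ) → ℕ
sumTo zero    f = f 0
sumTo (suc N) f = sumTo N f + f (suc N)

-- Formal power series in q, t, u with ℕ coefficients:
-- F a b c = coefficient of q^a t^b u^c.

FPS : Set
FPS = ℕ → ℕ → ℕ → ℕ

_≈ₛ_ : FPS → FPS → Set
F ≈ₛ G = ∀ a b c → F a b c ≡ G a b c

_⊛_ : FPS → FPS → FPS
(F ⊛ G) a b c =
  sumTo a (λ i → sumTo b (λ j → sumTo c (λ k →
    F i j k * G (a ∸ i) (b ∸ j) (c ∸ k))))

-- 1/(1 - q^j t) = Σ_m q^{jm} t^m
geomInv : ℕ → FPS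
geomInv j a b c = if (c ≡ᵇ 0) ∧ (a ≡ᵇ j * b) then 1 else 0

invProd : ℕ → FPS
invProd zero    = geomInv 0
invProd (suc n) = invProd n ⊛ geomInv (suc n)

-- colored letter a^c represented as (a , c)
-- Biagioli–Zeng order: a^c < b^d
_<col_ : ℕ × ℕ → ℕ × ℕ → Bool
(a , c) <col (b , d) =
     ((c ≡ᵇ 0) ∧ (d ≡ᵇ 0) ∧ (a <ᵇ b))
  ∨ ((0 <ᵇ c) ∧ (0 <ᵇ d) ∧ (b <ᵇ a))
  ∨ ((0 <ᵇ c) ∧ (d ≡ᵇ 0))

-- a permutation π of [n] in window form: π(i+1) = 1 + toℕ (lookup w i)
-- w encodes a permutation iff its entries are pairwise distinct
distinctᵇ : List ℕ → Bool
distinctᵇ []       = true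
distinctᵇ (x ∷ xs) = allᵇ (λ y → not (x ≡ᵇ y)) xs ∧ distinctᵇ xs

isPerm : {n : ℕ} → Vec (Fin n) n → Bool
isPerm w = distinctᵇ (map toℕ (toList w))

-- the element of G_ε with underlying permutation w, as the list of
-- colored letters π(0)^0, π(1)^{ε_{π(1)}}, …, π(n)^{ε_{π(n)}}  (π(0)=0)
coloredWindow : {r n : ℕ} → Vec (Fin r) n → Vec (Fin n) n → List (ℕ × ℕ)
coloredWindow ε w = (0 , 0) ∷ map (λ p → (suc (toℕ p) , toℕ (lookup ε p))) (toList w)

desList : ℕ → List (ℕ × ℕ) → List ℕ
desList i (x ∷ y ∷ rest) =
  if y <col x then i ∷ desList (suc i) (y ∷ rest) else desList (suc i) (y ∷ rest)
desList i _ = []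

Des : {r n : ℕ} → Vec (Fin r) n → Vec (Fin n) n → List ℕ
Des ε w = desList 0 (coloredWindow ε w)

des : {r n : ℕ} → Vec (Fin r) n → Vec (Fin n) n → ℕ
des ε w = length (Des ε w)

maj : {r n : ℕ} → Vec (Fin r) n → Vec (Fin n) n → ℕ
maj ε w = sum (Des ε w)

col : {r n : ℕ} → Vec (Fin r) n → ℕ
col ε = sum (map toℕ (toList ε))

numerator : {r n : ℕ} → Vec (Fin r) n → FPS
numerator {r} {n} ε a b c =
  count (λ w → isPerm w ∧ (maj ε w ≡ᵇ a) ∧ (des ε w ≡ᵇ b) ∧ (col ε ≡ᵇ c))
        (allVecs (allFin n) n)

-- m'(j,k) as the pair (exponent of q , exponent of u)
m'-aux : ℕ → ℕ → ℕ × ℕ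
m'-aux j zero    = (0 , 0)   -- unreachable: k = 0 forces j ≤ k
m'-aux j (suc k) = ((j ∸ 1) % suc k , (j ∸ 1) / suc k)

m' : ℕ → ℕ → ℕ × ℕ
m' j k = if j ≤ᵇ k then (j , 0) else m'-aux j k

-- exponents of q and u in ∏_i m'(v_i,k)  (the t-exponent of m(v,k) is k)
mq : {n : ℕ} → Vec ℕ n → ℕ → ℕ
mq v k = sum (map (λ x → proj₁ (m' x k)) (toList v))

mu : {n : ℕ} → Vec ℕ n → ℕ → ℕ
mu v k = sum (map (λ x → proj₂ (m' x k)) (toList v))

inL : {r n : ℕ} → Vec (Fin r) n → Vec ℕ n → ℕ → Bool
inL ε v k = allᵇ ok (toList (zip ε v))
  where
  ok : _ → Bool
  ok (e , x) = (k * toℕ e ≤ᵇ x) ∧ (x ≤ᵇ k * (toℕ e + 1))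
               ∧ ((toℕ e ≡ᵇ 0) ∨ (k * toℕ e <ᵇ x))

-- Σ_{(v,k)∈L_ε} m(v,k) as a series: coefficient of q^a t^b u^c counts
-- the (v,b) ∈ L_ε with monomial q^a t^b u^c.  For fixed k every such v
-- has entries in [0, k r] (since ε_i ≤ r-1), so enumerating that box is exhaustive.
coneSeries : {n : ℕ} → (r : ℕ) → Vec (Fin r) n → FPS
coneSeries {n} r ε a b c =
  count (λ v → inL ε v b ∧ (mq v b ≡ᵇ a) ∧ (mu v b ≡ᵇ c))
        (allVecs (upTo (suc (b * r))) n)

module Submission where

-- Proof strategy.  Both sides are formal power series with ℕ coefficients; we compare the
-- coefficients of q^a t^b u^c, so the t-degree b (= the cone level k) is fixed throughout.
--
-- (1) A point v of L_ε at level b has coordinates in (b, 2b] at the l coloured positions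
--     and in [0, b] elsewhere.  Its monomial has u-degree l and q-degree Σ_p h_p, where the
--     reduced value h_p is x_p - (b+1) (coloured) or x_p (uncoloured); thus h_p ∈ [0, b],
--     and h_p < b at coloured positions.
-- (2) For every such v there is exactly one permutation w ∈ G_ε such that
--     b ≥ h_{w(1)} ≥ … ≥ h_{w(n)}, strictly exactly at the descents of w (position 0
--     included): it lists the positions by decreasing lexicographic key (h_p, rank of the
--     letter p^{ε_p}).
-- (3) For fixed w, v ↦ (h_{w(1)}, …, h_{w(n)}) is a bijection onto the chains below b with
--     the descent pattern of w.  Removing the forced strict steps turns these chains into
--     nonincreasing sequences below b - des w with sum a - maj w, which are counted by the
--     coefficient of q^(a - maj w) t^(b - des w) in 1/∏_{j=0}^{n}(1 - q^j t).
-- (4) Summing (3) over w ∈ G_ε gives the coefficient of the right-hand side.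

open import Defs
open import Data.Bool using (Bool; true; false; T; _∧_; _∨_; not; if_then_else_)
open import Data.Bool.Properties using (∨-identityʳ)
open import Data.Empty using (⊥-elim)
open import Data.Fin using (Fin; zero; suc; toℕ; punchOut)
open import Data.Fin.Properties using (toℕ-injective; toℕ<n; any?; pigeonhole; punchOut-injective)
open import Data.List using (List; []; _∷_; length; map; concatMap; upTo; applyUpTo; _++_)
import Data.List as L
import Data.List.Properties as LP
open import Data.List.Membership.Propositional using (_∈_; _∉_; find; lose)
open import Data.List.Membership.Propositional.Properties
  using (∈-map⁺; ∈-map⁻; ∈-++⁻; ∈-upTo⁺; ∈-tabulate⁺; ∈-concatMap⁺; ∈-concatMap⁻)
open import Data.List.Relation.Binary.Pointwise using (Pointwise; []; _∷_)
open import Data.List.Relation.Unary.All using (All; []; _∷_)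
open import Data.List.Relation.Unary.AllPairs using ([]; _∷_)
open import Data.List.Relation.Unary.Any using (here; there)
open import Data.List.Relation.Unary.Unique.Propositional using (Unique)
open import Data.List.Relation.Unary.Unique.Propositional.Properties using (upTo⁺; tabulate⁺)
open import Data.Nat
open import Data.Nat.DivMod
open import Data.Nat.ListAction using (sum)
open import Data.Nat.Properties
open import Algebra.Properties.CommutativeSemigroup +-commutativeSemigroup using (interchange)
open import Data.Nat.Solver using (module +-*-Solver)
open import Data.Product using (_×_; _,_; proj₁; proj₂; ∃)
open import Data.Sum using (_⊎_; inj₁; inj₂; [_,_]′)
open import Data.Unit using (⊤; tt)
open import Data.Vec using (Vec; []; _∷_; lookup; toList; tabulate)
import Data.Vec as V
import Data.Vec.Properties as VP
open import Function using (_∘_; case_of_)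
open import Relation.Binary.Definitions using (DecidableEquality; tri<; tri≈; tri>)
open import Relation.Binary.PropositionalEquality
open import Relation.Nullary using (¬_; yes; no)

open +-*-Solver using (solve; _:+_; _:*_; _:=_; con)

-- The boolean tests of Defs against the corresponding relations on ℕ.  The primed
-- lemmas are the library's T-based ones restated with "≡ true", the form Defs uses.

≡ᵇ⇒≡′ : ∀ m n → (m ≡ᵇ n) ≡ true → m ≡ n
≡ᵇ⇒≡′ m n p = ≡ᵇ⇒≡ m n (subst T (sym p) tt)

≡ᵇ-refl : ∀ n → (n ≡ᵇ n) ≡ true
≡ᵇ-refl zero    = refl
≡ᵇ-refl (suc n) = ≡ᵇ-refl n

≡ᵇ-sym : ∀ m n → (m ≡ᵇ n) ≡ (n ≡ᵇ m)
≡ᵇ-sym zero    zero    = refl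
≡ᵇ-sym zero    (suc n) = refl
≡ᵇ-sym (suc m) zero    = refl
≡ᵇ-sym (suc m) (suc n) = ≡ᵇ-sym m n

≢⇒≡ᵇ-false : ∀ m n → m ≢ n → (m ≡ᵇ n) ≡ false
≢⇒≡ᵇ-false m n m≢n with m ≡ᵇ n in eq
... | true  = ⊥-elim (m≢n (≡ᵇ⇒≡′ m n eq))
... | false = refl

≤ᵇ⇒≤′ : ∀ m n → (m ≤ᵇ n) ≡ true → m ≤ n
≤ᵇ⇒≤′ m n p = ≤ᵇ⇒≤ m n (subst T (sym p) tt)

≤⇒≤ᵇ′ : ∀ {m n} → m ≤ n → (m ≤ᵇ n) ≡ true
≤⇒≤ᵇ′ {m} {n} m≤n with m ≤ᵇ n | ≤⇒≤ᵇ m≤n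
... | true | _ = refl

≰⇒≤ᵇ-false : ∀ {m n} → ¬ m ≤ n → (m ≤ᵇ n) ≡ false
≰⇒≤ᵇ-false {m} {n} m≰n with m ≤ᵇ n in eq
... | true  = ⊥-elim (m≰n (≤ᵇ⇒≤′ m n eq))
... | false = refl

<ᵇ⇒<′ : ∀ m n → (m <ᵇ n) ≡ true → m < n
<ᵇ⇒<′ m n = ≤ᵇ⇒≤′ (suc m) n

<⇒<ᵇ′ : ∀ {m n} → m < n → (m <ᵇ n) ≡ true
<⇒<ᵇ′ = ≤⇒≤ᵇ′

≮⇒<ᵇ-false : ∀ {m n} → ¬ m < n → (m <ᵇ n) ≡ false
≮⇒<ᵇ-false = ≰⇒≤ᵇ-false

<ᵇ-suc : ∀ m n → (m <ᵇ suc n) ≡ (m ≤ᵇ n)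
<ᵇ-suc zero    n = refl
<ᵇ-suc (suc m) n = refl

bool-ext : ∀ {x y : Bool} → (x ≡ true → y ≡ true) → (y ≡ true → x ≡ true) → x ≡ y
bool-ext {true}  {true}  f g = refl
bool-ext {true}  {false} f g = sym (f refl)
bool-ext {false} {true}  f g = g refl
bool-ext {false} {false} f g = refl

∧-true⁻ : ∀ a c → (a ∧ c) ≡ true → (a ≡ true) × (c ≡ true)
∧-true⁻ true true _ = refl , refl

∧-falseʳ : ∀ x → (x ∧ false) ≡ false
∧-falseʳ true  = refl
∧-falseʳ false = refl

ind : Bool → ℕ
ind b = if b then 1 else 0

cond : Bool → ℕ → ℕ
cond b x = if b then x else 0

cond-true : ∀ {b} x → b ≡ true → cond b x ≡ x
cond-true x refl = refl

cond-false : ∀ {b} x → b ≡ false → cond b x ≡ 0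
cond-false x refl = refl

cond-0 : ∀ b → cond b 0 ≡ 0
cond-0 true  = refl
cond-0 false = refl

cond-cong : ∀ b {x y} → (b ≡ true → x ≡ y) → cond b x ≡ cond b y
cond-cong true  h = h refl
cond-cong false h = refl

cond-swap : ∀ a b x → cond a (cond b x) ≡ cond b (cond a x)
cond-swap true  b     x = refl
cond-swap false true  x = refl
cond-swap false false x = refl

cond-idem : ∀ a x → cond a (cond a x) ≡ cond a x
cond-idem true  x = refl
cond-idem false x = refl

cond-*ˡ : ∀ b x y → cond b x * y ≡ cond b (x * y)
cond-*ˡ true  x y = refl
cond-*ˡ false x y = refl

sumTo-cong : ∀ N {f g : ℕ → ℕ} → (∀ i → i ≤ N → f i ≡ g i) → sumTo N f ≡ sumTo N g
sumTo-cong zero    e = e 0 z≤n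
sumTo-cong (suc N) e = cong₂ _+_ (sumTo-cong N (λ i i≤N → e i (m≤n⇒m≤1+n i≤N))) (e (suc N) ≤-refl)

sumTo-zero : ∀ N (f : ℕ → ℕ) → (∀ i → i ≤ N → f i ≡ 0) → sumTo N f ≡ 0
sumTo-zero zero    f e = e 0 z≤n
sumTo-zero (suc N) f e rewrite sumTo-zero N f (λ i i≤N → e i (m≤n⇒m≤1+n i≤N)) = e (suc N) ≤-refl

sumTo-+ : ∀ N (f g : ℕ → ℕ) → sumTo N (λ i → f i + g i) ≡ sumTo N f + sumTo N g
sumTo-+ zero    f g = refl
sumTo-+ (suc N) f g rewrite sumTo-+ N f g = interchange (sumTo N f) (sumTo N g) (f (suc N)) (g (suc N))

sumTo-swap : ∀ A B (f : ℕ → ℕ → ℕ) →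
  sumTo A (λ i → sumTo B (f i)) ≡ sumTo B (λ j → sumTo A (λ i → f i j))
sumTo-swap zero    B f = refl
sumTo-swap (suc A) B f rewrite sumTo-swap A B f = sym (sumTo-+ B (λ j → sumTo A (λ i → f i j)) (f (suc A)))

sumTo-suc : ∀ N (f : ℕ → ℕ) → sumTo (suc N) f ≡ f 0 + sumTo N (f ∘ suc)
sumTo-suc zero    f = refl
sumTo-suc (suc N) f rewrite sumTo-suc N f = +-assoc (f 0) (sumTo N (f ∘ suc)) (f (suc (suc N)))

sumTo-reflect : ∀ N (f : ℕ → ℕ) → sumTo N f ≡ sumTo N (λ i → f (N ∸ i))
sumTo-reflect zero    f = refl
sumTo-reflect (suc N) f =
  trans (cong (_+ f (suc N)) (sumTo-reflect N f))
        (trans (+-comm _ (f (suc N))) (sym (sumTo-suc N (λ i → f (suc N ∸ i)))))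

sumTo-trunc : ∀ k N (f : ℕ → ℕ) → k ≤ N → (∀ i → k < i → i ≤ N → f i ≡ 0) →
  sumTo N f ≡ sumTo k f
sumTo-trunc k zero    f z≤n e = refl
sumTo-trunc k (suc N) f k≤N e with m≤n⇒m<n∨m≡n k≤N
... | inj₂ refl = refl
... | inj₁ (s≤s k≤N′) =
  trans (cong₂ _+_ (sumTo-trunc k N f k≤N′ (λ i k<i i≤N → e i k<i (m≤n⇒m≤1+n i≤N)))
                   (e (suc N) (s≤s k≤N′) ≤-refl))
        (+-identityʳ (sumTo k f))

sumTo-delta : ∀ N k (f : ℕ → ℕ) →
  sumTo N (λ i → if i ≡ᵇ k then f i else 0) ≡ cond (k ≤ᵇ N) (f k)
sumTo-delta N k f with k ≤? N
... | yes k≤N rewrite ≤⇒≤ᵇ′ k≤N = trans (sumTo-trunc k N _ k≤N beyond) (upToK k)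
  where
  beyond : ∀ i → k < i → i ≤ N → (if i ≡ᵇ k then f i else 0) ≡ 0
  beyond i k<i _ rewrite ≢⇒≡ᵇ-false i k (λ e → <-irrefl (sym e) k<i) = refl
  below : ∀ k i → i ≤ k → (if i ≡ᵇ suc k then f i else 0) ≡ 0
  below k i i≤k rewrite ≢⇒≡ᵇ-false i (suc k) (λ e → <-irrefl e (s≤s i≤k)) = refl
  upToK : ∀ k → sumTo k (λ i → if i ≡ᵇ k then f i else 0) ≡ f k
  upToK zero    = refl
  upToK (suc k) rewrite ≡ᵇ-refl k = cong (_+ f (suc k)) (sumTo-zero k _ (below k))
... | no k≰N rewrite ≰⇒≤ᵇ-false k≰N = sumTo-zero N _ absent
  where
  absent : ∀ i → i ≤ N → (if i ≡ᵇ k then f i else 0) ≡ 0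
  absent i i≤N rewrite ≢⇒≡ᵇ-false i k (λ e → k≰N (subst (_≤ N) e i≤N)) = refl

sumTo-delta∸ : ∀ a K (g : ℕ → ℕ) →
  sumTo a (λ i → g i * (if a ∸ i ≡ᵇ K then 1 else 0)) ≡ cond (K ≤ᵇ a) (g (a ∸ K))
sumTo-delta∸ a K g =
  trans (sumTo-reflect a _) (trans (sumTo-cong a pointwise) (sumTo-delta a K (λ i → g (a ∸ i))))
  where
  pointwise : ∀ i → i ≤ a → g (a ∸ i) * (if a ∸ (a ∸ i) ≡ᵇ K then 1 else 0)
                          ≡ (if i ≡ᵇ K then g (a ∸ i) else 0)
  pointwise i i≤a rewrite m∸[m∸n]≡n i≤a with i ≡ᵇ K
  ... | true  = *-identityʳ (g (a ∸ i))
  ... | false = *-zeroʳ (g (a ∸ i))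

cond-sumTo : ∀ b N (f : ℕ → ℕ) → cond b (sumTo N f) ≡ sumTo N (λ i → cond b (f i))
cond-sumTo true  N f = refl
cond-sumTo false N f = sym (sumTo-zero N _ (λ _ _ → refl))

sumTo-triangle : ∀ z B (f : ℕ → ℕ) → z ≤ B → sumTo z f ≡ sumTo B (λ j → cond (j ≤ᵇ z) (f j))
sumTo-triangle z B f z≤B =
  sym (trans (sumTo-trunc z B _ z≤B (λ i z<i _ → cond-false (f i) (≰⇒≤ᵇ-false (<⇒≱ z<i))))
             (sumTo-cong z (λ i i≤z → cond-true (f i) (≤⇒≤ᵇ′ i≤z))))

≤-suc⁻ : ∀ {E N} → E ≤ suc N → E ≤ N ⊎ E ≡ suc N
≤-suc⁻ le with m≤n⇒m<n∨m≡n le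
... | inj₁ (s≤s E≤N) = inj₁ E≤N
... | inj₂ e         = inj₂ e

sumTo-shiftˡ : ∀ N E (f : ℕ → ℕ) →
  sumTo N (λ z → cond (E ≤ᵇ z) (f (z ∸ E))) ≡ cond (E ≤ᵇ N) (sumTo (N ∸ E) f)
sumTo-shiftˡ zero    zero    f = refl
sumTo-shiftˡ zero    (suc E) f = refl
sumTo-shiftˡ (suc N) E f rewrite sumTo-shiftˡ N E f with E ≤? N
... | yes E≤N rewrite ≤⇒≤ᵇ′ E≤N | ≤⇒≤ᵇ′ (m≤n⇒m≤1+n E≤N) | +-∸-assoc 1 E≤N = refl
... | no E≰N rewrite ≰⇒≤ᵇ-false E≰N with E ≟ suc N
...   | yes refl rewrite ≤⇒≤ᵇ′ (≤-refl {suc N}) | n∸n≡0 N = refl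
...   | no E≢ rewrite ≰⇒≤ᵇ-false {E} {suc N} (λ le → [ E≰N , E≢ ]′ (≤-suc⁻ le)) = refl

sumTo-shiftʳ : ∀ N E (f : ℕ → ℕ) →
  sumTo N (λ m → cond (m + E ≤ᵇ N) (f m)) ≡ cond (E ≤ᵇ N) (sumTo (N ∸ E) f)
sumTo-shiftʳ N E f with E ≤? N
... | yes E≤N rewrite ≤⇒≤ᵇ′ E≤N =
  trans (sumTo-trunc (N ∸ E) N _ (m∸n≤m N E)
          (λ i lt _ → cond-false (f i) (≰⇒≤ᵇ-false (λ le → <⇒≱ lt (fits⇒≤ i le)))))
        (sumTo-cong (N ∸ E) (λ i le → cond-true (f i) (≤⇒≤ᵇ′ (≤⇒fits i le))))
  where
  fits⇒≤ : ∀ i → i + E ≤ N → i ≤ N ∸ E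
  fits⇒≤ i le = subst (_≤ N ∸ E) (m+n∸n≡m i E) (∸-monoˡ-≤ E le)
  ≤⇒fits : ∀ i → i ≤ N ∸ E → i + E ≤ N
  ≤⇒fits i le = subst (i + E ≤_) (m∸n+n≡m E≤N) (+-monoˡ-≤ E le)
... | no E≰N rewrite ≰⇒≤ᵇ-false E≰N =
  sumTo-zero N _ (λ i _ → cond-false (f i) (≰⇒≤ᵇ-false (λ le → E≰N (≤-trans (m≤n+m E i) le))))

sumTo-shift : ∀ N E (f : ℕ → ℕ) →
  sumTo N (λ z → cond (E ≤ᵇ z) (f (z ∸ E))) ≡ sumTo N (λ m → cond (m + E ≤ᵇ N) (f m))
sumTo-shift N E f = trans (sumTo-shiftˡ N E f) (sym (sumTo-shiftʳ N E f))

sumL : {A : Set} → (A → ℕ) → List A → ℕ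
sumL f []       = 0
sumL f (x ∷ xs) = f x + sumL f xs

sum-map : {A : Set} (f : A → ℕ) (xs : List A) → sum (map f xs) ≡ sumL f xs
sum-map f []       = refl
sum-map f (x ∷ xs) = cong (f x +_) (sum-map f xs)

count-sumL : {A : Set} (p : A → Bool) (xs : List A) → count p xs ≡ sumL (λ x → ind (p x)) xs
count-sumL p []       = refl
count-sumL p (x ∷ xs) with p x
... | true  = cong suc (count-sumL p xs)
... | false = count-sumL p xs

sumL-cong : {A : Set} {f g : A → ℕ} (xs : List A) → (∀ x → f x ≡ g x) → sumL f xs ≡ sumL g xs
sumL-cong []       e = refl
sumL-cong (x ∷ xs) e = cong₂ _+_ (e x) (sumL-cong xs e)

sumL-zero : {A : Set} (xs : List A) → sumL (λ _ → 0) xs ≡ 0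
sumL-zero []       = refl
sumL-zero (x ∷ xs) = sumL-zero xs

sumL-+ : {A : Set} (f g : A → ℕ) (xs : List A) →
  sumL (λ x → f x + g x) xs ≡ sumL f xs + sumL g xs
sumL-+ f g []       = refl
sumL-+ f g (x ∷ xs) rewrite sumL-+ f g xs = interchange (f x) (g x) (sumL f xs) (sumL g xs)

sumL-++ : {A : Set} (f : A → ℕ) (xs ys : List A) → sumL f (xs ++ ys) ≡ sumL f xs + sumL f ys
sumL-++ f []       ys = refl
sumL-++ f (x ∷ xs) ys rewrite sumL-++ f xs ys = sym (+-assoc (f x) _ _)

sumL-map : {A B : Set} (f : B → ℕ) (g : A → B) (xs : List A) → sumL f (map g xs) ≡ sumL (f ∘ g) xs
sumL-map f g []       = refl
sumL-map f g (x ∷ xs) = cong (f (g x) +_) (sumL-map f g xs)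

sumL-concatMap : {A B : Set} (f : B → ℕ) (g : A → List B) (xs : List A) →
  sumL f (concatMap g xs) ≡ sumL (λ x → sumL f (g x)) xs
sumL-concatMap f g []       = refl
sumL-concatMap f g (x ∷ xs) rewrite sumL-++ f (g x) (concatMap g xs) =
  cong (sumL f (g x) +_) (sumL-concatMap f g xs)

sumL-swap : {A B : Set} (g : A → B → ℕ) (xs : List A) (ys : List B) →
  sumL (λ x → sumL (g x) ys) xs ≡ sumL (λ y → sumL (λ x → g x y) xs) ys
sumL-swap g []       ys = sym (sumL-zero ys)
sumL-swap g (x ∷ xs) ys rewrite sumL-swap g xs ys =
  sym (sumL-+ (g x) (λ y → sumL (λ x → g x y) xs) ys)

sumL-*ʳ : {A : Set} (f : A → ℕ) (xs : List A) (c : ℕ) → sumL f xs * c ≡ sumL (λ x → f x * c) xs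
sumL-*ʳ f []       c = refl
sumL-*ʳ f (x ∷ xs) c rewrite *-distribʳ-+ c (f x) (sumL f xs) = cong (f x * c +_) (sumL-*ʳ f xs c)

sumL-cond : {A : Set} (b : Bool) (g : A → ℕ) (xs : List A) →
  sumL (λ x → cond b (g x)) xs ≡ cond b (sumL g xs)
sumL-cond true  g xs = refl
sumL-cond false g xs = sumL-zero xs

sumTo-sumL : {A : Set} (N : ℕ) (g : ℕ → A → ℕ) (xs : List A) →
  sumTo N (λ i → sumL (g i) xs) ≡ sumL (λ x → sumTo N (λ i → g i x)) xs
sumTo-sumL zero    g xs = refl
sumTo-sumL (suc N) g xs rewrite sumTo-sumL N g xs =
  sym (sumL-+ (λ x → sumTo N (λ i → g i x)) (g (suc N)) xs)

sumL-applyUpTo : ∀ N (f g : ℕ → ℕ) → sumL f (applyUpTo g (suc N)) ≡ sumTo N (f ∘ g)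
sumL-applyUpTo zero    f g = +-identityʳ _
sumL-applyUpTo (suc N) f g rewrite sumL-applyUpTo N f (g ∘ suc) = sym (sumTo-suc N (f ∘ g))

sumL-upTo : ∀ N (f : ℕ → ℕ) → sumL f (upTo (suc N)) ≡ sumTo N f
sumL-upTo N f = sumL-applyUpTo N f (λ x → x)

-- The series has no u, and its coefficient
-- of q^A t^B (invCoeff n A B) counts nonincreasing sequences B ≥ z₁ ≥ … ≥ z_n ≥ 0 of
-- sum A: multiplicity m_j of the factor q^j t corresponds to z_i - z_{i+1}.

geomInv-u : ∀ j x y c → 0 < c → geomInv (suc j) x y c ≡ 0
geomInv-u j x y (suc c) _ = refl

invProd-u : ∀ n a b c → 0 < c → invProd n a b c ≡ 0
invProd-u zero    a b (suc c) _   = refl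
invProd-u (suc n) a b c       0<c =
  sumTo-zero a _ λ i _ → sumTo-zero b _ λ j _ → sumTo-zero c _ λ k _ → term i j k
  where
  term : ∀ i j k → invProd n i j k * geomInv (suc n) (a ∸ i) (b ∸ j) (c ∸ k) ≡ 0
  term i j zero    = trans (cong (invProd n i j 0 *_) (geomInv-u n (a ∸ i) (b ∸ j) c 0<c))
                           (*-zeroʳ (invProd n i j 0))
  term i j (suc k) rewrite invProd-u n i j (suc k) (s≤s z≤n) = refl

invCoeff : ℕ → ℕ → ℕ → ℕ
invCoeff n a b = invProd n a b 0

-- Since invProd n has no u, a Cauchy product with it only sees the top u-degree of F.
sumTo-invProd-u : ∀ n c (F : ℕ → ℕ) x y →
  sumTo c (λ k → F k * invProd n x y (c ∸ k)) ≡ F c * invCoeff n x y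
sumTo-invProd-u n zero    F x y = refl
sumTo-invProd-u n (suc c) F x y rewrite n∸n≡0 c =
  cong (_+ F (suc c) * invCoeff n x y) (sumTo-zero c _ lower)
  where
  lower : ∀ k → k ≤ c → F k * invProd n x y (suc c ∸ k) ≡ 0
  lower k k≤c = trans (cong (F k *_) (invProd-u n x y (suc c ∸ k) (m<n⇒0<n∸m (s≤s k≤c))))
                      (*-zeroʳ (F k))

-- Multiplying F by 1/(1 - q^{n+1} t): take B ∸ j copies of q^{n+1} t.
appendFactor : (ℕ → ℕ → ℕ) → ℕ → ℕ → ℕ → ℕ
appendFactor F n A B = sumTo B (λ j → cond (suc n * (B ∸ j) ≤ᵇ A) (F (A ∸ suc n * (B ∸ j)) j))

invCoeff-suc : ∀ n A B → invCoeff (suc n) A B ≡ appendFactor (invCoeff n) n A B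
invCoeff-suc n A B =
  trans (sumTo-swap A B (λ i j → invCoeff n i j * geomInv (suc n) (A ∸ i) (B ∸ j) 0))
        (sumTo-cong B (λ j _ → sumTo-delta∸ A (suc n * (B ∸ j)) (λ i → invCoeff n i j)))

nonincCount : ℕ → ℕ → ℕ → ℕ
nonincCount zero    A B = cond (A ≡ᵇ 0) 1
nonincCount (suc n) A B = sumTo B (λ z → cond (z ≤ᵇ A) (nonincCount n (A ∸ z) z))

nonincCount-one : ∀ A B → nonincCount 1 A B ≡ appendFactor (nonincCount 0) 0 A B
nonincCount-one A B = sym (trans (sumTo-reflect B _) (sumTo-cong B reindex))
  where
  reindex : ∀ i → i ≤ B →
    cond (1 * (B ∸ (B ∸ i)) ≤ᵇ A) (nonincCount 0 (A ∸ 1 * (B ∸ (B ∸ i))) (B ∸ i))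
    ≡ cond (i ≤ᵇ A) (nonincCount 0 (A ∸ i) i)
  reindex i i≤B rewrite m∸[m∸n]≡n i≤B | *-identityˡ i = refl

-- The double sum to which both recursions for sequences of length n+2 reduce:
-- j bounds the last n entries and m is the amount added to the first two levels.
liftedPairs : ℕ → ℕ → ℕ → ℕ
liftedPairs n A B = sumTo B (λ j → sumTo B (λ m →
  cond ((j + m ≤ᵇ B) ∧ (j + suc (suc n) * m ≤ᵇ A)) (nonincCount n (A ∸ (j + suc (suc n) * m)) j)))

lift-arith : ∀ n m j → m + j + suc n * m ≡ j + suc (suc n) * m
lift-arith = solve 3 (λ n m j → m :+ j :+ (con 1 :+ n) :* m := j :+ (con 2 :+ n) :* m) refl

lift-fits : ∀ n A j m → j + suc (suc n) * m ≤ A → suc n * m ≤ A ∸ (m + j)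
lift-fits n A j m le = subst (_≤ A ∸ (m + j)) (m+n∸m≡n (m + j) (suc n * m))
  (∸-monoˡ-≤ (m + j) (subst (_≤ A) (sym (lift-arith n m j)) le))

lift-unfits : ∀ n A j m → m + j ≤ A → suc n * m ≤ A ∸ (m + j) → j + suc (suc n) * m ≤ A
lift-unfits n A j m le₁ le₂ = subst (_≤ A) (lift-arith n m j)
  (subst (m + j + suc n * m ≤_) (m+[n∸m]≡n le₁) (+-monoʳ-≤ (m + j) le₂))

-- The summand of the front recursion for length n+2 after expanding the tail by hyp:
-- first entry z, tail of length n below j shifted up by z ∸ j.
frontTerm : ℕ → ℕ → ℕ → ℕ → ℕ
frontTerm n A z j =
  cond (z ≤ᵇ A) (cond (suc n * (z ∸ j) ≤ᵇ A ∸ z) (nonincCount n (A ∸ z ∸ suc n * (z ∸ j)) j))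

frontTerm-lifted : ∀ n A B j m → cond (m + j ≤ᵇ B) (frontTerm n A (m + j) j)
  ≡ cond ((j + m ≤ᵇ B) ∧ (j + suc (suc n) * m ≤ᵇ A)) (nonincCount n (A ∸ (j + suc (suc n) * m)) j)
frontTerm-lifted n A B j m rewrite m+n∸n≡m m j | +-comm j m with m + j ≤? B
... | no m+j≰B rewrite ≰⇒≤ᵇ-false m+j≰B = refl
... | yes m+j≤B rewrite ≤⇒≤ᵇ′ m+j≤B with j + suc (suc n) * m ≤? A
...   | yes le rewrite ≤⇒≤ᵇ′ le
                     | ≤⇒≤ᵇ′ {m + j} {A} (≤-trans (m≤m+n (m + j) (suc n * m))
                                            (subst (_≤ A) (sym (lift-arith n m j)) le))
                     | ≤⇒≤ᵇ′ (lift-fits n A j m le)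
  = cong (λ x → nonincCount n x j)
         (trans (∸-+-assoc A (m + j) (suc n * m)) (cong (A ∸_) (lift-arith n m j)))
...   | no nle rewrite ≰⇒≤ᵇ-false nle with m + j ≤? A
...     | no nle′ rewrite ≰⇒≤ᵇ-false nle′ = refl
...     | yes le′ rewrite ≤⇒≤ᵇ′ le′
                        | ≰⇒≤ᵇ-false {suc n * m} {A ∸ (m + j)} (λ le₂ → nle (lift-unfits n A j m le′ le₂))
  = refl

-- Front recursion (first entry z = m + j), then the recursion hypothesis for length n+1.
front⇒liftedPairs : ∀ n A B →
  (∀ A′ B′ → nonincCount (suc n) A′ B′ ≡ appendFactor (nonincCount n) n A′ B′) →
  nonincCount (suc (suc n)) A B ≡ liftedPairs n A B
front⇒liftedPairs n A B hyp = begin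
    sumTo B (λ z → cond (z ≤ᵇ A) (nonincCount (suc n) (A ∸ z) z))
  ≡⟨ sumTo-cong B (λ z z≤B → cond-cong (z ≤ᵇ A) (λ _ →
       trans (hyp (A ∸ z) z) (sumTo-triangle z B _ z≤B))) ⟩
    sumTo B (λ z → cond (z ≤ᵇ A) (sumTo B (λ j → cond (j ≤ᵇ z) (inner z j))))
  ≡⟨ sumTo-cong B (λ z _ → trans (cond-sumTo (z ≤ᵇ A) B _)
       (sumTo-cong B (λ j _ → cond-swap (z ≤ᵇ A) (j ≤ᵇ z) (inner z j)))) ⟩
    sumTo B (λ z → sumTo B (λ j → cond (j ≤ᵇ z) (frontTerm n A z j)))
  ≡⟨ sumTo-swap B B _ ⟩
    sumTo B (λ j → sumTo B (λ z → cond (j ≤ᵇ z) (frontTerm n A z j)))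
  ≡⟨ sumTo-cong B (λ j _ → trans (sumTo-cong B (λ z _ → recentre j z))
                                 (sumTo-shift B j (λ m → frontTerm n A (m + j) j))) ⟩
    sumTo B (λ j → sumTo B (λ m → cond (m + j ≤ᵇ B) (frontTerm n A (m + j) j)))
  ≡⟨ sumTo-cong B (λ j _ → sumTo-cong B (λ m _ → frontTerm-lifted n A B j m)) ⟩
    liftedPairs n A B
  ∎
  where
  open ≡-Reasoning
  inner : ℕ → ℕ → ℕ
  inner z j = cond (suc n * (z ∸ j) ≤ᵇ A ∸ z) (nonincCount n (A ∸ z ∸ suc n * (z ∸ j)) j)
  recentre : ∀ j z → cond (j ≤ᵇ z) (frontTerm n A z j) ≡ cond (j ≤ᵇ z) (frontTerm n A (z ∸ j + j) j)
  recentre j z = cond-cong (j ≤ᵇ z) (λ e → cong (λ w → frontTerm n A w j) (sym (m∸n+n≡m (≤ᵇ⇒≤′ j z e))))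

-- The summand of the back recursion for length n+2 after expanding by the front recursion:
-- m copies of the factor q^{n+2} t, then first entry z of the remaining sequence.
backTerm : ℕ → ℕ → ℕ → ℕ → ℕ → ℕ
backTerm n A B m z = cond (k * m ≤ᵇ A) (cond (z ≤ᵇ B ∸ m)
  (cond (z ≤ᵇ A ∸ k * m) (nonincCount n (A ∸ k * m ∸ z) z)))
  where k = suc (suc n)

backTerm-lifted : ∀ n A B z m → m ≤ B → backTerm n A B m z
  ≡ cond ((z + m ≤ᵇ B) ∧ (z + suc (suc n) * m ≤ᵇ A)) (nonincCount n (A ∸ (z + suc (suc n) * m)) z)
backTerm-lifted n A B z m m≤B with z + m ≤? B
... | no nle rewrite ≰⇒≤ᵇ-false nle
                   | ≰⇒≤ᵇ-false {z} {B ∸ m}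
                       (λ le → nle (subst (z + m ≤_) (m∸n+n≡m m≤B) (+-monoˡ-≤ m le)))
  = cond-0 (suc (suc n) * m ≤ᵇ A)
... | yes le rewrite ≤⇒≤ᵇ′ le
                   | ≤⇒≤ᵇ′ {z} {B ∸ m} (subst (_≤ B ∸ m) (m+n∸n≡m z m) (∸-monoˡ-≤ m le))
  with z + suc (suc n) * m ≤? A
...   | yes le₂ rewrite ≤⇒≤ᵇ′ le₂ | ≤⇒≤ᵇ′ {suc (suc n) * m} {A} (≤-trans (m≤n+m (suc (suc n) * m) z) le₂)
                      | ≤⇒≤ᵇ′ {z} {A ∸ suc (suc n) * m}
                          (subst (_≤ A ∸ suc (suc n) * m) (m+n∸n≡m z (suc (suc n) * m))
                                 (∸-monoˡ-≤ (suc (suc n) * m) le₂))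
  = cong (λ x → nonincCount n x z)
         (trans (∸-+-assoc A (suc (suc n) * m) z) (cong (A ∸_) (+-comm (suc (suc n) * m) z)))
...   | no nle₂ rewrite ≰⇒≤ᵇ-false nle₂ with suc (suc n) * m ≤? A
...     | no nle₃ rewrite ≰⇒≤ᵇ-false nle₃ = refl
...     | yes le₃ rewrite ≤⇒≤ᵇ′ le₃
                        | ≰⇒≤ᵇ-false {z} {A ∸ suc (suc n) * m}
                            (λ le₄ → nle₂ (subst (z + suc (suc n) * m ≤_) (m∸n+n≡m le₃)
                                                  (+-monoˡ-≤ (suc (suc n) * m) le₄)))
  = refl

-- Back recursion (m copies of q^{n+2} t), then the front recursion for length n+1.
back⇒liftedPairs : ∀ n A B → appendFactor (nonincCount (suc n)) (suc n) A B ≡ liftedPairs n A B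
back⇒liftedPairs n A B = begin
    sumTo B (λ j → cond (k * (B ∸ j) ≤ᵇ A) (nonincCount (suc n) (A ∸ k * (B ∸ j)) j))
  ≡⟨ sumTo-reflect B _ ⟩
    sumTo B (λ m → cond (k * (B ∸ (B ∸ m)) ≤ᵇ A) (nonincCount (suc n) (A ∸ k * (B ∸ (B ∸ m))) (B ∸ m)))
  ≡⟨ sumTo-cong B expand ⟩
    sumTo B (λ m → sumTo B (backTerm n A B m))
  ≡⟨ sumTo-swap B B _ ⟩
    sumTo B (λ z → sumTo B (λ m → backTerm n A B m z))
  ≡⟨ sumTo-cong B (λ z _ → sumTo-cong B (λ m m≤B → backTerm-lifted n A B z m m≤B)) ⟩
    liftedPairs n A B
  ∎
  where
  open ≡-Reasoning
  k = suc (suc n)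
  inner : ℕ → ℕ → ℕ
  inner m z = cond (z ≤ᵇ A ∸ k * m) (nonincCount n (A ∸ k * m ∸ z) z)
  expand : ∀ m → m ≤ B →
    cond (k * (B ∸ (B ∸ m)) ≤ᵇ A) (nonincCount (suc n) (A ∸ k * (B ∸ (B ∸ m))) (B ∸ m))
    ≡ sumTo B (backTerm n A B m)
  expand m m≤B rewrite m∸[m∸n]≡n m≤B =
    trans (cond-cong (k * m ≤ᵇ A) (λ _ → sumTo-triangle (B ∸ m) B (inner m) (m∸n≤m B m)))
          (cond-sumTo (k * m ≤ᵇ A) B _)

nonincCount-suc : ∀ n A B → nonincCount (suc n) A B ≡ appendFactor (nonincCount n) n A B
nonincCount-suc zero    A B = nonincCount-one A B
nonincCount-suc (suc n) A B =
  trans (front⇒liftedPairs n A B (nonincCount-suc n)) (sym (back⇒liftedPairs n A B))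

invCoeff≡nonincCount : ∀ n A B → invCoeff n A B ≡ nonincCount n A B
invCoeff≡nonincCount zero    A B = refl
invCoeff≡nonincCount (suc n) A B =
  trans (invCoeff-suc n A B)
  (trans (sumTo-cong B (λ j _ → cond-cong (suc n * (B ∸ j) ≤ᵇ A) (λ _ → invCoeff≡nonincCount n _ j)))
         (sym (nonincCount-suc n A B)))

-- Chains with a prescribed descent pattern.  A pattern is a list of booleans; the chain
-- y ≥ h₁ ≥ h₂ ≥ … must step strictly down exactly where the pattern says true.

follows : Bool → ℕ → ℕ → Bool
follows d y z = if d then z <ᵇ y else z ≤ᵇ y

follows⇒≤ : ∀ d y z → follows d y z ≡ true → z ≤ y
follows⇒≤ true  y z e = <⇒≤ (<ᵇ⇒<′ z y e)
follows⇒≤ false y z e = ≤ᵇ⇒≤′ z y e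

isChain : List Bool → ℕ → List ℕ → Bool
isChain []       y []       = true
isChain (d ∷ ds) y (h ∷ hs) = follows d y h ∧ isChain ds h hs
isChain []       y (_ ∷ _)  = false
isChain (_ ∷ _)  y []       = false

chainsBelow : List Bool → ℕ → ℕ → ℕ
chainsBelow []       y a = cond (a ≡ᵇ 0) 1
chainsBelow (d ∷ ds) y a =
  sumTo y (λ z → cond (follows d y z) (cond (z ≤ᵇ a) (chainsBelow ds z (a ∸ z))))

patternMaj : ℕ → List Bool → ℕ
patternMaj i []       = 0
patternMaj i (d ∷ ds) = (if d then i else 0) + patternMaj (suc i) ds

patternDes : List Bool → ℕ
patternDes []       = 0
patternDes (d ∷ ds) = ind d + patternDes ds

patternMaj-suc : ∀ i ds → patternMaj (suc i) ds ≡ patternMaj i ds + patternDes ds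
patternMaj-suc i []           = refl
patternMaj-suc i (true  ∷ ds) rewrite patternMaj-suc (suc i) ds =
  solve 3 (λ i x y → con 1 :+ i :+ (x :+ y) := i :+ x :+ (con 1 :+ y)) refl
        i (patternMaj (suc i) ds) (patternDes ds)
patternMaj-suc i (false ∷ ds) rewrite patternMaj-suc (suc i) ds = refl

patternMaj-cons : ∀ d ds → patternMaj 0 (d ∷ ds) ≡ patternMaj 0 ds + patternDes ds
patternMaj-cons true  ds = patternMaj-suc 0 ds
patternMaj-cons false ds = patternMaj-suc 0 ds

reorder : ∀ m E M → m + E + M ≡ m + (M + E)
reorder m E M = trans (+-assoc m E M) (cong (m +_) (+-comm E M))

fits-after : ∀ m E M a → M + E ≤ a → m ≤ a ∸ (M + E) → m + E + M ≤ a
fits-after m E M a l₂ le =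
  subst (_≤ a) (sym (reorder m E M)) (subst (m + (M + E) ≤_) (m∸n+n≡m l₂) (+-monoˡ-≤ (M + E) le))

guards-exchange : ∀ m E M a (X : ℕ → ℕ) →
  cond (m + E ≤ᵇ a) (cond (M ≤ᵇ a ∸ (m + E)) (X (a ∸ (m + E) ∸ M)))
  ≡ cond (M + E ≤ᵇ a) (cond (m ≤ᵇ a ∸ (M + E)) (X (a ∸ (M + E) ∸ m)))
guards-exchange m E M a X with m + E + M ≤? a
... | yes le rewrite ≤⇒≤ᵇ′ {m + E} (≤-trans (m≤m+n (m + E) M) le)
                   | ≤⇒≤ᵇ′ {M + E} (≤-trans (m≤n+m (M + E) m) (subst (_≤ a) (reorder m E M) le))
                   | ≤⇒≤ᵇ′ {M} {a ∸ (m + E)}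
                       (subst (_≤ a ∸ (m + E)) (m+n∸m≡n (m + E) M) (∸-monoˡ-≤ (m + E) le))
                   | ≤⇒≤ᵇ′ {m} {a ∸ (M + E)}
                       (subst (_≤ a ∸ (M + E)) (m+n∸n≡m m (M + E))
                              (∸-monoˡ-≤ (M + E) (subst (_≤ a) (reorder m E M) le)))
  = cong X (begin
      a ∸ (m + E) ∸ M   ≡⟨ ∸-+-assoc a (m + E) M ⟩
      a ∸ (m + E + M)   ≡⟨ cong (a ∸_) (reorder m E M) ⟩
      a ∸ (m + (M + E)) ≡⟨ cong (a ∸_) (+-comm m (M + E)) ⟩
      a ∸ (M + E + m)   ≡⟨ sym (∸-+-assoc a (M + E) m) ⟩
      a ∸ (M + E) ∸ m   ∎)
  where open ≡-Reasoning
... | no nle with m + E ≤? a | M + E ≤? a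
...   | no n₁  | no n₂  rewrite ≰⇒≤ᵇ-false n₁ | ≰⇒≤ᵇ-false n₂ = refl
...   | no n₁  | yes l₂ rewrite ≰⇒≤ᵇ-false n₁ | ≤⇒≤ᵇ′ l₂
                              | ≰⇒≤ᵇ-false {m} {a ∸ (M + E)}
                                  (λ le → n₁ (≤-trans (m≤m+n (m + E) M) (fits-after m E M a l₂ le))) = refl
...   | yes l₁ | no n₂  rewrite ≤⇒≤ᵇ′ l₁ | ≰⇒≤ᵇ-false n₂
                              | ≰⇒≤ᵇ-false {M} {a ∸ (m + E)}
                                  (λ le → nle (subst (m + E + M ≤_) (m+[n∸m]≡n l₁) (+-monoʳ-≤ (m + E) le)))
  = refl
...   | yes l₁ | yes l₂ rewrite ≤⇒≤ᵇ′ l₁ | ≤⇒≤ᵇ′ l₂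
                              | ≰⇒≤ᵇ-false {M} {a ∸ (m + E)}
                                  (λ le → nle (subst (m + E + M ≤_) (m+[n∸m]≡n l₁) (+-monoʳ-≤ (m + E) le)))
                              | ≰⇒≤ᵇ-false {m} {a ∸ (M + E)} (λ le → nle (fits-after m E M a l₂ le)) = refl

follows-shift : ∀ d m E b x →
  cond (m + E ≤ᵇ b) (cond (follows d b (m + E)) x) ≡ cond (m + (ind d + E) ≤ᵇ b) x
follows-shift false m E b x = cond-idem (m + E ≤ᵇ b) x
follows-shift true  m E b x rewrite +-suc m E with suc (m + E) ≤? b
... | yes le rewrite ≤⇒≤ᵇ′ le | ≤⇒≤ᵇ′ {m + E} {b} (≤-trans (n≤1+n _) le) = refl
... | no nle rewrite ≰⇒≤ᵇ-false nle = cond-0 (m + E ≤ᵇ b)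

-- Subtracting the forced strict steps: a chain below b with pattern ds and sum a is a
-- nonincreasing sequence below b ∸ des(ds) of sum a ∸ maj(ds).
chainsBelow-shift : ∀ ds b a → chainsBelow ds b a ≡
  cond (patternMaj 0 ds ≤ᵇ a) (cond (patternDes ds ≤ᵇ b)
    (nonincCount (length ds) (a ∸ patternMaj 0 ds) (b ∸ patternDes ds)))
chainsBelow-shift []       b a = refl
chainsBelow-shift (d ∷ ds) b a = begin
    sumTo b (λ z → cond (follows d b z) (cond (z ≤ᵇ a) (chainsBelow ds z (a ∸ z))))
  ≡⟨ sumTo-cong b (λ z _ → unfold z) ⟩
    sumTo b (λ z → cond (E ≤ᵇ z) (F (z ∸ E)))
  ≡⟨ sumTo-shift b E F ⟩
    sumTo b (λ m → cond (m + E ≤ᵇ b) (F m))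
  ≡⟨ sumTo-cong b (λ m _ →
       trans (cong (cond (m + E ≤ᵇ b) ∘ cond (follows d b (m + E)))
                   (guards-exchange m E M a (λ x → nonincCount n x m)))
             (follows-shift d m E b _)) ⟩
    sumTo b (λ m → cond (m + (ind d + E) ≤ᵇ b) (G m))
  ≡⟨ sumTo-shiftʳ b (ind d + E) G ⟩
    cond (ind d + E ≤ᵇ b) (sumTo (b ∸ (ind d + E)) G)
  ≡⟨ cong (cond (ind d + E ≤ᵇ b)) (sym (cond-sumTo (M + E ≤ᵇ a) (b ∸ (ind d + E)) _)) ⟩
    cond (ind d + E ≤ᵇ b) (cond (M + E ≤ᵇ a) (nonincCount (suc n) (a ∸ (M + E)) (b ∸ (ind d + E))))
  ≡⟨ cond-swap (ind d + E ≤ᵇ b) (M + E ≤ᵇ a) _ ⟩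
    cond (M + E ≤ᵇ a) (cond (ind d + E ≤ᵇ b) (nonincCount (suc n) (a ∸ (M + E)) (b ∸ (ind d + E))))
  ≡⟨ cong (λ w → cond (w ≤ᵇ a) (cond (ind d + E ≤ᵇ b) (nonincCount (suc n) (a ∸ w) (b ∸ (ind d + E)))))
          (sym (patternMaj-cons d ds)) ⟩
    cond (patternMaj 0 (d ∷ ds) ≤ᵇ a) (cond (patternDes (d ∷ ds) ≤ᵇ b)
      (nonincCount (length (d ∷ ds)) (a ∸ patternMaj 0 (d ∷ ds)) (b ∸ patternDes (d ∷ ds))))
  ∎
  where
  open ≡-Reasoning
  n = length ds
  M = patternMaj 0 ds
  E = patternDes ds
  F : ℕ → ℕ
  F m = cond (follows d b (m + E))
          (cond (m + E ≤ᵇ a) (cond (M ≤ᵇ a ∸ (m + E)) (nonincCount n (a ∸ (m + E) ∸ M) m)))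
  G : ℕ → ℕ
  G m = cond (M + E ≤ᵇ a) (cond (m ≤ᵇ a ∸ (M + E)) (nonincCount n (a ∸ (M + E) ∸ m) m))
  unfold : ∀ z → cond (follows d b z) (cond (z ≤ᵇ a) (chainsBelow ds z (a ∸ z)))
                 ≡ cond (E ≤ᵇ z) (F (z ∸ E))
  unfold z rewrite chainsBelow-shift ds z (a ∸ z) with E ≤? z
  ... | yes E≤z rewrite ≤⇒≤ᵇ′ E≤z | m∸n+n≡m E≤z = refl
  ... | no E≰z rewrite ≰⇒≤ᵇ-false E≰z with follows d b z | z ≤ᵇ a | M ≤ᵇ a ∸ z
  ...   | true  | true  | true  = refl
  ...   | true  | true  | false = refl
  ...   | true  | false | _     = refl
  ...   | false | _     | _     = refl

+≡ᵇ-split : ∀ x s a → (x + s ≡ᵇ a) ≡ ((x ≤ᵇ a) ∧ (s ≡ᵇ a ∸ x))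
+≡ᵇ-split zero    s a       = refl
+≡ᵇ-split (suc x) s zero    = refl
+≡ᵇ-split (suc x) s (suc a) rewrite <ᵇ-suc x a = +≡ᵇ-split x s a

chain-cons-ind : ∀ d ds y x hs a → ind ((follows d y x ∧ isChain ds x hs) ∧ (x + sum hs ≡ᵇ a))
  ≡ cond (follows d y x) (cond (x ≤ᵇ a) (ind (isChain ds x hs ∧ (sum hs ≡ᵇ a ∸ x))))
chain-cons-ind d ds y x hs a rewrite +≡ᵇ-split x (sum hs) a
  with follows d y x | x ≤ᵇ a | isChain ds x hs
... | true  | true  | true  = refl
... | true  | true  | false = refl
... | true  | false | true  = refl
... | true  | false | false = refl
... | false | _     | _     = refl

count-chains : ∀ ds N y a → y ≤ N →
  count (λ h → isChain ds y (toList h) ∧ (sum (toList h) ≡ᵇ a)) (allVecs (upTo (suc N)) (length ds))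
  ≡ chainsBelow ds y a
count-chains []       N y zero    _   = refl
count-chains []       N y (suc a) _   = refl
count-chains (d ∷ ds) N y a       y≤N = begin
    count p (concatMap (λ x → map (x ∷_) (allVecs U n)) U)
  ≡⟨ count-sumL p (concatMap (λ x → map (x ∷_) (allVecs U n)) U) ⟩
    sumL (λ h → ind (p h)) (concatMap (λ x → map (x ∷_) (allVecs U n)) U)
  ≡⟨ sumL-concatMap (λ h → ind (p h)) (λ x → map (x ∷_) (allVecs U n)) U ⟩
    sumL (λ x → sumL (λ h → ind (p h)) (map (x ∷_) (allVecs U n))) U
  ≡⟨ sumL-cong U (λ x → sumL-map (λ h → ind (p h)) (x ∷_) (allVecs U n)) ⟩
    sumL (λ x → sumL (λ h → ind (p (x ∷ h))) (allVecs U n)) U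
  ≡⟨ sumL-upTo N (λ x → sumL (λ h → ind (p (x ∷ h))) (allVecs U n)) ⟩
    sumTo N (λ x → sumL (λ h → ind (p (x ∷ h))) (allVecs U n))
  ≡⟨ sumTo-cong N (λ x _ → firstEntry x) ⟩
    sumTo N f
  ≡⟨ sumTo-trunc y N f y≤N (λ i y<i _ → cond-false _ (tooBig i y<i)) ⟩
    sumTo y f
  ∎
  where
  open ≡-Reasoning
  U = upTo (suc N)
  n = length ds
  p : Vec ℕ (suc n) → Bool
  p h = isChain (d ∷ ds) y (toList h) ∧ (sum (toList h) ≡ᵇ a)
  f : ℕ → ℕ
  f x = cond (follows d y x) (cond (x ≤ᵇ a) (chainsBelow ds x (a ∸ x)))
  tooBig : ∀ i → y < i → follows d y i ≡ false
  tooBig i y<i with follows d y i in e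
  ... | true  = ⊥-elim (<⇒≱ y<i (follows⇒≤ d y i e))
  ... | false = refl
  rest : ℕ → Vec ℕ n → Bool
  rest x h = isChain ds x (toList h) ∧ (sum (toList h) ≡ᵇ a ∸ x)
  firstEntry : ∀ x → sumL (λ h → ind (p (x ∷ h))) (allVecs U n) ≡ f x
  firstEntry x =
    trans (sumL-cong (allVecs U n) (λ h → chain-cons-ind d ds y x (toList h) a))
    (trans (sumL-cond (follows d y x) (λ h → cond (x ≤ᵇ a) (ind (rest x h))) (allVecs U n))
    (cond-cong (follows d y x) (λ e →
      trans (sumL-cond (x ≤ᵇ a) (λ h → ind (rest x h)) (allVecs U n))
      (cond-cong (x ≤ᵇ a) (λ _ →
        trans (sym (count-sumL (rest x) (allVecs U n)))
              (count-chains ds N x (a ∸ x) (≤-trans (follows⇒≤ d y x e) y≤N)))))))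

count-chains-box : ∀ ds m y a → length ds ≡ m →
  count (λ (h : Vec ℕ m) → isChain ds y (toList h) ∧ (sum (toList h) ≡ᵇ a)) (allVecs (upTo (suc y)) m)
  ≡ chainsBelow ds y a
count-chains-box ds .(length ds) y a refl = count-chains ds y y a ≤-refl

Nodup : {A : Set} → List A → Set
Nodup []       = ⊤
Nodup (x ∷ xs) = (x ∉ xs) × Nodup xs

Unique⇒Nodup : {A : Set} {xs : List A} → Unique xs → Nodup xs
Unique⇒Nodup []      = tt
Unique⇒Nodup (a ∷ u) = all≢⇒∉ a , Unique⇒Nodup u
  where
  all≢⇒∉ : {A : Set} {x : A} {xs : List A} → All (λ y → x ≢ y) xs → x ∉ xs
  all≢⇒∉ (px ∷ _)   (here e)  = px e
  all≢⇒∉ (_  ∷ pxs) (there m) = all≢⇒∉ pxs m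

count-zero : {A : Set} {p : A → Bool} (xs : List A) → (∀ x → x ∈ xs → p x ≡ false) → count p xs ≡ 0
count-zero []       e = refl
count-zero {p = p} (x ∷ xs) e with p x | e x (here refl)
... | false | _ = count-zero xs (λ y m → e y (there m))

module Removal {A : Set} (_≟_ : DecidableEquality A) where

  remove : A → List A → List A
  remove x []       = []
  remove x (y ∷ ys) with x ≟ y
  ... | yes _ = ys
  ... | no  _ = y ∷ remove x ys

  ∈-remove⁺ : ∀ {z x ys} → z ∈ ys → z ≢ x → z ∈ remove x ys
  ∈-remove⁺ {z} {x} {y ∷ ys} m ne with x ≟ y
  ∈-remove⁺ {z} {x} {y ∷ ys} (here refl) ne | yes refl = ⊥-elim (ne refl)
  ∈-remove⁺ {z} {x} {y ∷ ys} (there m)   ne | yes refl = m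
  ∈-remove⁺ {z} {x} {y ∷ ys} (here e)    ne | no _     = here e
  ∈-remove⁺ {z} {x} {y ∷ ys} (there m)   ne | no _     = there (∈-remove⁺ m ne)

  ∈-remove⁻ : ∀ {z x ys} → z ∈ remove x ys → z ∈ ys
  ∈-remove⁻ {z} {x} {y ∷ ys} m with x ≟ y
  ... | yes _ = there m
  ∈-remove⁻ {z} {x} {y ∷ ys} (here e)  | no _ = here e
  ∈-remove⁻ {z} {x} {y ∷ ys} (there m) | no _ = there (∈-remove⁻ m)

  count-remove : ∀ (q : A → Bool) {x ys} → x ∈ ys → q x ≡ true →
    count q ys ≡ suc (count q (remove x ys))
  count-remove q {x} {y ∷ ys} m qx with x ≟ y
  count-remove q {x} {y ∷ ys} m         qx | yes refl rewrite qx = refl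
  count-remove q {x} {y ∷ ys} (here e)  qx | no ne = ⊥-elim (ne e)
  count-remove q {x} {y ∷ ys} (there m) qx | no ne with q y
  ... | true  = cong suc (count-remove q m qx)
  ... | false = count-remove q m qx

  sumL-remove : ∀ (F : A → ℕ) {x ys} → x ∈ ys → sumL F ys ≡ F x + sumL F (remove x ys)
  sumL-remove F {x} {y ∷ ys} m with x ≟ y
  sumL-remove F {x} {y ∷ ys} m         | yes refl = refl
  sumL-remove F {x} {y ∷ ys} (here e)  | no ne = ⊥-elim (ne e)
  sumL-remove F {x} {y ∷ ys} (there m) | no ne rewrite sumL-remove F m =
    trans (sym (+-assoc (F y) (F x) _))
          (trans (cong (_+ sumL F (remove x ys)) (+-comm (F y) (F x))) (+-assoc (F x) (F y) _))

  Nodup-remove : ∀ x ys → Nodup ys → Nodup (remove x ys)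
  Nodup-remove x []       nd         = tt
  Nodup-remove x (y ∷ ys) (y∉ , nd) with x ≟ y
  ... | yes _ = nd
  ... | no  _ = (λ m → y∉ (∈-remove⁻ m)) , Nodup-remove x ys nd

  ∉-remove : ∀ x ys → Nodup ys → x ∉ remove x ys
  ∉-remove x (y ∷ ys) (y∉ , nd) m with x ≟ y
  ∉-remove x (y ∷ ys) (y∉ , nd) m         | yes refl = y∉ m
  ∉-remove x (y ∷ ys) (y∉ , nd) (here e)  | no ne = ne e
  ∉-remove x (y ∷ ys) (y∉ , nd) (there m) | no ne = ∉-remove x ys nd m

  sumL-sameElements : ∀ (F : A → ℕ) (xs ys : List A) → Nodup xs → Nodup ys →
    (∀ z → z ∈ xs → z ∈ ys) → (∀ z → z ∈ ys → z ∈ xs) → sumL F xs ≡ sumL F ys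
  sumL-sameElements F []       []       _         _   _  _  = refl
  sumL-sameElements F []       (y ∷ ys) _         _   _  h₂ = case h₂ y (here refl) of λ ()
  sumL-sameElements F (x ∷ xs) ys       (x∉ , nd) ndy h₁ h₂ =
    trans (cong (F x +_) (sumL-sameElements F xs (remove x ys) nd (Nodup-remove x ys ndy)
             (λ z m → ∈-remove⁺ (h₁ z (there m)) (λ e → x∉ (subst (_∈ xs) e m)))
             back))
          (sym (sumL-remove F (h₁ x (here refl))))
    where
    back : ∀ z → z ∈ remove x ys → z ∈ xs
    back z m with h₂ z (∈-remove⁻ m)
    ... | here refl = ⊥-elim (∉-remove x ys ndy m)
    ... | there m′  = m′

  count-unique : ∀ (p : A → Bool) (xs : List A) x₀ → Nodup xs → x₀ ∈ xs → p x₀ ≡ true →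
    (∀ x → x ∈ xs → p x ≡ true → x ≡ x₀) → count p xs ≡ 1
  count-unique p (x ∷ xs) x₀ (x∉ , nd) (here refl) px₀ only rewrite px₀ =
    cong suc (count-zero xs others)
    where
    others : ∀ y → y ∈ xs → p y ≡ false
    others y m with p y in py
    ... | true  = ⊥-elim (x∉ (subst (_∈ xs) (only y (there m) py) m))
    ... | false = refl
  count-unique p (x ∷ xs) x₀ (x∉ , nd) (there m₀) px₀ only with p x in px
  ... | true  = ⊥-elim (x∉ (subst (_∈ xs) (sym (only x (here refl) px)) m₀))
  ... | false = count-unique p xs x₀ nd m₀ px₀ (λ y m py → only y (there m) py)

count-≤-injection : {A B : Set} (_≟_ : DecidableEquality B)
  (p : A → Bool) (q : B → Bool) (f : A → B) (xs : List A) (ys : List B) → Nodup xs →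
  (∀ x → x ∈ xs → p x ≡ true → (f x ∈ ys) × (q (f x) ≡ true)) →
  (∀ x x′ → x ∈ xs → x′ ∈ xs → p x ≡ true → p x′ ≡ true → f x ≡ f x′ → x ≡ x′) →
  count p xs ≤ count q ys
count-≤-injection _≟_ p q f []       ys nd        into inj = z≤n
count-≤-injection _≟_ p q f (x ∷ xs) ys (x∉ , nd) into inj with p x in px
... | false = count-≤-injection _≟_ p q f xs ys nd (λ z m → into z (there m))
                (λ z z′ m m′ → inj z z′ (there m) (there m′))
... | true  =
  subst (suc (count p xs) ≤_) (sym (count-remove q fx∈ qfx))
    (s≤s (count-≤-injection _≟_ p q f xs (remove (f x) ys) nd into′
            (λ z z′ m m′ → inj z z′ (there m) (there m′))))
  where
  open Removal _≟_
  fx∈ = proj₁ (into x (here refl) px)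
  qfx = proj₂ (into x (here refl) px)
  into′ : ∀ z → z ∈ xs → p z ≡ true → (f z ∈ remove (f x) ys) × (q (f z) ≡ true)
  into′ z m pz =
    ∈-remove⁺ (proj₁ (into z (there m) pz))
              (λ e → x∉ (subst (_∈ xs) (inj z x (there m) (here refl) pz px e) m)) ,
    proj₂ (into z (there m) pz)

count-bijection : {A B : Set} → DecidableEquality A → DecidableEquality B →
  (p : A → Bool) (q : B → Bool) (f : A → B) (g : B → A) (xs : List A) (ys : List B) →
  Nodup xs → Nodup ys →
  (∀ x → x ∈ xs → p x ≡ true → (f x ∈ ys) × (q (f x) ≡ true) × (g (f x) ≡ x)) →
  (∀ y → y ∈ ys → q y ≡ true → (g y ∈ xs) × (p (g y) ≡ true) × (f (g y) ≡ y)) →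
  count p xs ≡ count q ys
count-bijection _≟A_ _≟B_ p q f g xs ys ndx ndy hf hg =
  ≤-antisym
    (count-≤-injection _≟B_ p q f xs ys ndx (λ x m px → proj₁ (hf x m px) , proj₁ (proj₂ (hf x m px)))
       (λ x x′ m m′ px px′ e → trans (sym (proj₂ (proj₂ (hf x m px))))
                                      (trans (cong g e) (proj₂ (proj₂ (hf x′ m′ px′))))))
    (count-≤-injection _≟A_ q p g ys xs ndy (λ y m qy → proj₁ (hg y m qy) , proj₁ (proj₂ (hg y m qy)))
       (λ y y′ m m′ qy qy′ e → trans (sym (proj₂ (proj₂ (hg y m qy))))
                                      (trans (cong f e) (proj₂ (proj₂ (hg y′ m′ qy′))))))

Nodup-++ : {A : Set} (xs ys : List A) → Nodup xs → Nodup ys → (∀ z → z ∈ xs → z ∉ ys) →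
  Nodup (xs ++ ys)
Nodup-++ []       ys _         ndy _        = ndy
Nodup-++ (x ∷ xs) ys (x∉ , nd) ndy disjoint =
  (λ m → case ∈-++⁻ xs m of λ { (inj₁ m₁) → x∉ m₁ ; (inj₂ m₂) → disjoint x (here refl) m₂ }) ,
  Nodup-++ xs ys nd ndy (λ z m → disjoint z (there m))

Nodup-map : {A B : Set} (f : A → B) (xs : List A) → (∀ {x y} → f x ≡ f y → x ≡ y) →
  Nodup xs → Nodup (map f xs)
Nodup-map f []       inj _         = tt
Nodup-map f (x ∷ xs) inj (x∉ , nd) =
  (λ m → let (y , y∈ , e) = ∈-map⁻ f m in x∉ (subst (_∈ xs) (sym (inj e)) y∈)) ,
  Nodup-map f xs inj nd

Nodup-allVecs : {A : Set} (xs : List A) (n : ℕ) → Nodup xs → Nodup (allVecs xs n)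
Nodup-allVecs xs zero    nd = (λ ()) , tt
Nodup-allVecs xs (suc n) nd = go xs nd
  where
  head-injective : ∀ {a b} {u w : Vec _ n} → Vec._∷_ a u ≡ b ∷ w → a ≡ b
  head-injective refl = refl
  go : (ys : List _) → Nodup ys → Nodup (concatMap (λ x → map (x ∷_) (allVecs xs n)) ys)
  go []       _          = tt
  go (y ∷ ys) (y∉ , ndy) =
    Nodup-++ (map (y ∷_) (allVecs xs n)) _
      (Nodup-map (y ∷_) _ (λ { refl → refl }) (Nodup-allVecs xs n nd)) (go ys ndy)
      (λ z m₁ m₂ →
        let (v , _ , e₁)      = ∈-map⁻ (y ∷_) m₁
            (y′ , y′∈ , m₃)   = find (∈-concatMap⁻ (λ x → map (x ∷_) (allVecs xs n)) m₂)
            (v′ , _ , e₂)     = ∈-map⁻ (y′ ∷_) m₃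
        in y∉ (subst (_∈ ys) (head-injective (trans (sym e₂) e₁)) y′∈))

∈-allVecs : {A : Set} (xs : List A) (n : ℕ) (v : Vec A n) → (∀ i → lookup v i ∈ xs) →
  v ∈ allVecs xs n
∈-allVecs xs zero    []      h = here refl
∈-allVecs xs (suc n) (x ∷ v) h =
  ∈-concatMap⁺ (λ y → map (y ∷_) (allVecs xs n))
    (lose (h zero) (∈-map⁺ (x ∷_) (∈-allVecs xs n v (λ i → h (suc i)))))

Nodup-upTo : ∀ N → Nodup (upTo N)
Nodup-upTo N = Unique⇒Nodup (upTo⁺ N)

Nodup-allFin : ∀ n → Nodup (L.allFin n)
Nodup-allFin n = Unique⇒Nodup (tabulate⁺ (λ e → e))

∈-allFin : ∀ {n} (i : Fin n) → i ∈ L.allFin n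
∈-allFin i = ∈-tabulate⁺ i

∈-upTo-suc : ∀ {i N} → i ≤ N → i ∈ upTo (suc N)
∈-upTo-suc le = ∈-upTo⁺ (s≤s le)

sumFin : ∀ {n} → (Fin n → ℕ) → ℕ
sumFin {zero}  G = 0
sumFin {suc n} G = G zero + sumFin (G ∘ suc)

sumFin-cong : ∀ {n} {F G : Fin n → ℕ} → (∀ p → F p ≡ G p) → sumFin F ≡ sumFin G
sumFin-cong {zero}  e = refl
sumFin-cong {suc n} e = cong₂ _+_ (e zero) (sumFin-cong (λ p → e (suc p)))

sumL-allFin : ∀ {n} (G : Fin n → ℕ) → sumL G (L.allFin n) ≡ sumFin G
sumL-allFin G = tabulated G (λ i → i)
  where
  tabulated : ∀ {n} {A : Set} (G : A → ℕ) (f : Fin n → A) → sumL G (L.tabulate f) ≡ sumFin (G ∘ f)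
  tabulated {zero}  G f = refl
  tabulated {suc n} G f = cong (G (f zero) +_) (tabulated G (f ∘ suc))

sumL-toList : ∀ {n} {A : Set} (F : A → ℕ) (v : Vec A n) → sumL F (toList v) ≡ sumFin (λ p → F (lookup v p))
sumL-toList F []      = refl
sumL-toList F (x ∷ v) = cong (F x +_) (sumL-toList F v)

sumFin-initial : ∀ m k → k ≤ m → sumFin {m} (λ p → ind (toℕ p <ᵇ k)) ≡ k
sumFin-initial m       zero    _         = none m
  where
  none : ∀ m → sumFin {m} (λ p → ind (toℕ p <ᵇ 0)) ≡ 0
  none zero    = refl
  none (suc m) = none m
sumFin-initial (suc m) (suc k) (s≤s k≤m) = cong suc (sumFin-initial m k k≤m)

∈-toList-lookup : ∀ {n} {A : Set} (v : Vec A n) i → lookup v i ∈ toList v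
∈-toList-lookup (x ∷ v) zero    = here refl
∈-toList-lookup (x ∷ v) (suc i) = there (∈-toList-lookup v i)

lookup-injective : ∀ {n} {A : Set} (v : Vec A n) → Nodup (toList v) →
  ∀ i j → lookup v i ≡ lookup v j → i ≡ j
lookup-injective (x ∷ v) nd        zero    zero    e = refl
lookup-injective (x ∷ v) (x∉ , nd) zero    (suc j) e = ⊥-elim (x∉ (subst (_∈ toList v) (sym e) (∈-toList-lookup v j)))
lookup-injective (x ∷ v) (x∉ , nd) (suc i) zero    e = ⊥-elim (x∉ (subst (_∈ toList v) e (∈-toList-lookup v i)))
lookup-injective (x ∷ v) (x∉ , nd) (suc i) (suc j) e = cong suc (lookup-injective v nd i j e)

lookup-ext : ∀ {m} {A : Set} (u v : Vec A m) → (∀ i → lookup u i ≡ lookup v i) → u ≡ v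
lookup-ext u v e = trans (sym (VP.tabulate∘lookup u)) (trans (VP.tabulate-cong e) (VP.tabulate∘lookup v))

injective⇒surjective : ∀ {n} (f : Fin n → Fin n) → (∀ i j → f i ≡ f j → i ≡ j) →
  ∀ p → ∃ λ i → f i ≡ p
injective⇒surjective {suc m} f inj p with any? (λ i → f i Data.Fin.≟ p)
... | yes hit  = hit
... | no  miss =
  let (i , j , i<j , same) = pigeonhole (n<1+n m) squeeze
  in ⊥-elim (<-irrefl (cong toℕ (inj i j (punchOut-injective (avoid i) (avoid j) same))) i<j)
  where
  avoid : ∀ i → p ≢ f i
  avoid i e = miss (i , sym e)
  squeeze : Fin (suc m) → Fin m
  squeeze i = punchOut (avoid i)

allᵇ-≢⇒∉ : ∀ {n} (p : Fin n) (ps : List (Fin n)) →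
  allᵇ (λ y → not (toℕ p ≡ᵇ y)) (map toℕ ps) ≡ true → p ∉ ps
allᵇ-≢⇒∉ p (q ∷ ps) h (here refl) with toℕ p ≡ᵇ toℕ p | ≡ᵇ-refl (toℕ p)
allᵇ-≢⇒∉ p (q ∷ ps) () (here refl) | true | refl
allᵇ-≢⇒∉ p (q ∷ ps) h (there m) with not (toℕ p ≡ᵇ toℕ q)
allᵇ-≢⇒∉ p (q ∷ ps) h (there m) | true = allᵇ-≢⇒∉ p ps h m

∉⇒allᵇ-≢ : ∀ {n} (p : Fin n) (ps : List (Fin n)) → p ∉ ps →
  allᵇ (λ y → not (toℕ p ≡ᵇ y)) (map toℕ ps) ≡ true
∉⇒allᵇ-≢ p []       _ = refl
∉⇒allᵇ-≢ p (q ∷ ps) h with toℕ p ≡ᵇ toℕ q in e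
... | true  = ⊥-elim (h (here (toℕ-injective (≡ᵇ⇒≡′ _ _ e))))
... | false = ∉⇒allᵇ-≢ p ps (λ m → h (there m))

distinctᵇ⇒Nodup : ∀ {n} (ps : List (Fin n)) → distinctᵇ (map toℕ ps) ≡ true → Nodup ps
distinctᵇ⇒Nodup []       _ = tt
distinctᵇ⇒Nodup (p ∷ ps) h
  with allᵇ (λ y → not (toℕ p ≡ᵇ y)) (map toℕ ps) in e | distinctᵇ (map toℕ ps) in e₂
... | true | true = allᵇ-≢⇒∉ p ps e , distinctᵇ⇒Nodup ps e₂

Nodup⇒distinctᵇ : ∀ {n} (ps : List (Fin n)) → Nodup ps → distinctᵇ (map toℕ ps) ≡ true
Nodup⇒distinctᵇ []       _          = refl
Nodup⇒distinctᵇ (p ∷ ps) (p∉ , nd) rewrite ∉⇒allᵇ-≢ p ps p∉ = Nodup⇒distinctᵇ ps nd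

module Window {n : ℕ} (w : Vec (Fin n) n) (isPerm-w : isPerm w ≡ true) where

  nodup : Nodup (toList w)
  nodup = distinctᵇ⇒Nodup (toList w) isPerm-w

  onto : ∀ p → ∃ λ i → lookup w i ≡ p
  onto = injective⇒surjective (lookup w) (lookup-injective w nodup)

  inv : Fin n → Fin n
  inv p = proj₁ (onto p)

  lookup-inv : ∀ p → lookup w (inv p) ≡ p
  lookup-inv p = proj₂ (onto p)

  inv-lookup : ∀ i → inv (lookup w i) ≡ i
  inv-lookup i = lookup-injective w nodup _ _ (lookup-inv (lookup w i))

  ∈-window : ∀ p → p ∈ toList w
  ∈-window p = subst (_∈ toList w) (lookup-inv p) (∈-toList-lookup w (inv p))

  sumL-window : ∀ (F : Fin n → ℕ) → sumL F (toList w) ≡ sumFin F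
  sumL-window F =
    trans (Removal.sumL-sameElements (Data.Fin._≟_ {n}) F (toList w) (L.allFin n) nodup (Nodup-allFin n)
             (λ z _ → ∈-allFin z) (λ z _ → ∈-window z))
          (sumL-allFin F)

-- A lexicographic key: order first by value x, then by decreasing rank r (all ranks < M).
-- The step conditions of chains become comparisons of keys.

lex-< : ∀ M x₁ x₂ s₁ s₂ → s₂ < M → x₂ < x₁ → x₂ * M + s₂ < x₁ * M + s₁
lex-< M x₁ x₂ s₁ s₂ s₂<M x₂<x₁ =
  <-≤-trans (+-monoʳ-< (x₂ * M) s₂<M)
  (≤-trans (≤-reflexive (+-comm (x₂ * M) M)) (≤-trans (*-monoˡ-≤ M x₂<x₁) (m≤m+n (x₁ * M) s₁)))

lex-<⁻ : ∀ M x₁ x₂ s₁ s₂ → s₁ < M → s₂ < M → x₂ * M + s₂ < x₁ * M + s₁ →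
  x₂ < x₁ ⊎ (x₂ ≡ x₁ × s₂ < s₁)
lex-<⁻ M x₁ x₂ s₁ s₂ s₁<M s₂<M lt with <-cmp x₂ x₁
... | tri< a _ _    = inj₁ a
... | tri≈ _ refl _ = inj₂ (refl , +-cancelˡ-< (x₂ * M) s₂ s₁ lt)
... | tri> _ _ c    = ⊥-elim (<-asym lt (lex-< M x₂ x₁ s₂ s₁ s₁<M c))

lex-≡⁻ : ∀ M x₁ x₂ s₁ s₂ → s₁ < M → s₂ < M → x₂ * M + s₂ ≡ x₁ * M + s₁ → s₂ ≡ s₁
lex-≡⁻ M x₁ x₂ s₁ s₂ s₁<M s₂<M e with <-cmp x₂ x₁
... | tri< a _ _    = ⊥-elim (<-irrefl e (lex-< M x₁ x₂ s₁ s₂ s₂<M a))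
... | tri≈ _ refl _ = +-cancelˡ-≡ (x₂ * M) s₂ s₁ e
... | tri> _ _ c    = ⊥-elim (<-irrefl (sym e) (lex-< M x₂ x₁ s₂ s₁ s₁<M c))

revRank : ℕ → ℕ → ℕ
revRank M r = M ∸ suc r

revRank< : ∀ M r → r < M → revRank M r < M
revRank< M r r<M = ∸-monoʳ-< {M} {suc r} {0} (s≤s z≤n) r<M

revRank-anti : ∀ M r₁ r₂ → r₂ < M → r₁ < r₂ → revRank M r₂ < revRank M r₁
revRank-anti M r₁ r₂ r₂<M lt = ∸-monoʳ-< (s≤s lt) r₂<M

revRank-anti⁻ : ∀ M r₁ r₂ → r₁ < M → r₂ < M → revRank M r₂ < revRank M r₁ → r₁ < r₂
revRank-anti⁻ M r₁ r₂ r₁<M r₂<M lt with <-cmp r₁ r₂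
... | tri< a _ _    = a
... | tri≈ _ refl _ = ⊥-elim (<-irrefl refl lt)
... | tri> _ _ c    = ⊥-elim (<-asym lt (revRank-anti M r₂ r₁ r₁<M c))

revRank-injective : ∀ M r₁ r₂ → r₁ < M → r₂ < M → revRank M r₁ ≡ revRank M r₂ → r₁ ≡ r₂
revRank-injective M r₁ r₂ r₁<M r₂<M e with <-cmp r₁ r₂
... | tri< a _ _ = ⊥-elim (<-irrefl (sym e) (revRank-anti M r₁ r₂ r₂<M a))
... | tri≈ _ x _ = x
... | tri> _ _ c = ⊥-elim (<-irrefl e (revRank-anti M r₂ r₁ r₁<M c))

lexKey : ℕ → ℕ → ℕ → ℕ
lexKey M r x = x * M + revRank M r

follows-lexKey : ∀ M r₁ r₂ x₁ x₂ → r₁ < M → r₂ < M → r₁ ≢ r₂ →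
  follows (r₂ <ᵇ r₁) x₁ x₂ ≡ (lexKey M r₂ x₂ <ᵇ lexKey M r₁ x₁)
follows-lexKey M r₁ r₂ x₁ x₂ r₁<M r₂<M r₁≢r₂ = bool-ext toKey fromKey
  where
  toKey : follows (r₂ <ᵇ r₁) x₁ x₂ ≡ true → (lexKey M r₂ x₂ <ᵇ lexKey M r₁ x₁) ≡ true
  toKey s with r₂ <ᵇ r₁ in d
  ... | true  = <⇒<ᵇ′ (lex-< M x₁ x₂ _ _ (revRank< M r₂ r₂<M) (<ᵇ⇒<′ x₂ x₁ s))
  ... | false with m≤n⇒m<n∨m≡n (≤ᵇ⇒≤′ x₂ x₁ s)
  ...   | inj₁ lt   = <⇒<ᵇ′ (lex-< M x₁ x₂ _ _ (revRank< M r₂ r₂<M) lt)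
  ...   | inj₂ refl = <⇒<ᵇ′ (+-monoʳ-< (x₂ * M) (revRank-anti M r₁ r₂ r₂<M r₁<r₂))
    where
    r₁<r₂ : r₁ < r₂
    r₁<r₂ with <-cmp r₁ r₂
    ... | tri< a _ _ = a
    ... | tri≈ _ e _ = ⊥-elim (r₁≢r₂ e)
    ... | tri> _ _ c = case trans (sym (<⇒<ᵇ′ c)) d of λ ()
  fromKey : (lexKey M r₂ x₂ <ᵇ lexKey M r₁ x₁) ≡ true → follows (r₂ <ᵇ r₁) x₁ x₂ ≡ true
  fromKey k with lex-<⁻ M x₁ x₂ _ _ (revRank< M r₁ r₁<M) (revRank< M r₂ r₂<M) (<ᵇ⇒<′ _ _ k)
  ... | inj₁ lt with r₂ <ᵇ r₁
  ...   | true  = <⇒<ᵇ′ lt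
  ...   | false = ≤⇒≤ᵇ′ (<⇒≤ lt)
  fromKey k | inj₂ (refl , slt) with r₂ <ᵇ r₁ in d
  ...   | true  = ⊥-elim (<-asym (<ᵇ⇒<′ r₂ r₁ d) (revRank-anti⁻ M r₁ r₂ r₁<M r₂<M slt))
  ...   | false = ≤⇒≤ᵇ′ (≤-refl {x₁})

descending : List ℕ → Bool
descending (x ∷ y ∷ rest) = (y <ᵇ x) ∧ descending (y ∷ rest)
descending _              = true

descending-tail : ∀ k ks → descending (k ∷ ks) ≡ true → descending ks ≡ true
descending-tail k []       d = refl
descending-tail k (y ∷ ks) d = proj₂ (∧-true⁻ _ _ d)

descending-below : ∀ k ks → descending (k ∷ ks) ≡ true → ∀ z → z ∈ ks → z < k
descending-below k (y ∷ ks) d z (here refl) = <ᵇ⇒<′ _ _ (proj₁ (∧-true⁻ _ _ d))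
descending-below k (y ∷ ks) d z (there m)   =
  let (h₁ , h₂) = ∧-true⁻ _ _ d in <-trans (descending-below y ks h₂ z m) (<ᵇ⇒<′ _ _ h₁)

descending-unique : ∀ xs ys → descending xs ≡ true → descending ys ≡ true →
  (∀ z → z ∈ xs → z ∈ ys) → (∀ z → z ∈ ys → z ∈ xs) → xs ≡ ys
descending-unique []       []       _  _  _  _  = refl
descending-unique []       (y ∷ ys) _  _  _  h₂ = case h₂ y (here refl) of λ ()
descending-unique (x ∷ xs) []       _  _  h₁ _  = case h₁ x (here refl) of λ ()
descending-unique (x ∷ xs) (y ∷ ys) dx dy h₁ h₂ = cong₂ _∷_ x≡y
  (descending-unique xs ys (descending-tail x xs dx) (descending-tail y ys dy)
    (λ z m → dropHead (descending-below x xs dx z m) (h₁ z (there m)))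
    (λ z m → dropHead′ (descending-below y ys dy z m) (h₂ z (there m))))
  where
  x≤y : x ≤ y
  x≤y with h₁ x (here refl)
  ... | here e  = ≤-reflexive e
  ... | there m = <⇒≤ (descending-below y ys dy x m)
  y≤x : y ≤ x
  y≤x with h₂ y (here refl)
  ... | here e  = ≤-reflexive e
  ... | there m = <⇒≤ (descending-below x xs dx y m)
  x≡y = ≤-antisym x≤y y≤x
  dropHead : ∀ {z} → z < x → z ∈ (y ∷ ys) → z ∈ ys
  dropHead z<x (here refl) = ⊥-elim (<-irrefl (sym x≡y) z<x)
  dropHead z<x (there m)   = m
  dropHead′ : ∀ {z} → z < y → z ∈ (x ∷ xs) → z ∈ xs
  dropHead′ z<y (here refl) = ⊥-elim (<-irrefl x≡y z<y)
  dropHead′ z<y (there m)   = m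

module SortByKey {A : Set} (key : A → ℕ) (key-injective : ∀ x y → key x ≡ key y → x ≡ y) where

  insert : A → List A → List A
  insert x []       = x ∷ []
  insert x (y ∷ ys) = if key y <ᵇ key x then x ∷ y ∷ ys else y ∷ insert x ys

  sort : List A → List A
  sort []       = []
  sort (x ∷ xs) = insert x (sort xs)

  ∈-insert⁻ : ∀ x ys z → z ∈ insert x ys → z ≡ x ⊎ z ∈ ys
  ∈-insert⁻ x []       z (here e) = inj₁ e
  ∈-insert⁻ x (y ∷ ys) z m with key y <ᵇ key x
  ∈-insert⁻ x (y ∷ ys) z (here e)  | true  = inj₁ e
  ∈-insert⁻ x (y ∷ ys) z (there m) | true  = inj₂ m
  ∈-insert⁻ x (y ∷ ys) z (here e)  | false = inj₂ (here e)
  ∈-insert⁻ x (y ∷ ys) z (there m) | false with ∈-insert⁻ x ys z m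
  ... | inj₁ e  = inj₁ e
  ... | inj₂ m′ = inj₂ (there m′)

  ∈-insert⁺ : ∀ x ys z → z ≡ x ⊎ z ∈ ys → z ∈ insert x ys
  ∈-insert⁺ x []       z (inj₁ e) = here e
  ∈-insert⁺ x (y ∷ ys) z h with key y <ᵇ key x
  ∈-insert⁺ x (y ∷ ys) z (inj₁ e)         | true  = here e
  ∈-insert⁺ x (y ∷ ys) z (inj₂ m)         | true  = there m
  ∈-insert⁺ x (y ∷ ys) z (inj₁ e)         | false = there (∈-insert⁺ x ys z (inj₁ e))
  ∈-insert⁺ x (y ∷ ys) z (inj₂ (here e))  | false = here e
  ∈-insert⁺ x (y ∷ ys) z (inj₂ (there m)) | false = there (∈-insert⁺ x ys z (inj₂ m))

  length-insert : ∀ x ys → length (insert x ys) ≡ suc (length ys)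
  length-insert x []       = refl
  length-insert x (y ∷ ys) with key y <ᵇ key x
  ... | true  = refl
  ... | false = cong suc (length-insert x ys)

  ∈-sort⁻ : ∀ xs z → z ∈ sort xs → z ∈ xs
  ∈-sort⁻ (x ∷ xs) z m with ∈-insert⁻ x (sort xs) z m
  ... | inj₁ e  = here e
  ... | inj₂ m′ = there (∈-sort⁻ xs z m′)

  ∈-sort⁺ : ∀ xs z → z ∈ xs → z ∈ sort xs
  ∈-sort⁺ (x ∷ xs) z (here e)  = ∈-insert⁺ x (sort xs) z (inj₁ e)
  ∈-sort⁺ (x ∷ xs) z (there m) = ∈-insert⁺ x (sort xs) z (inj₂ (∈-sort⁺ xs z m))

  length-sort : ∀ xs → length (sort xs) ≡ length xs
  length-sort []       = refl
  length-sort (x ∷ xs) = trans (length-insert x (sort xs)) (cong suc (length-sort xs))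

  insert-descending : ∀ k x ys → key x < k → x ∉ ys →
    descending (k ∷ map key ys) ≡ true → descending (k ∷ map key (insert x ys)) ≡ true
  insert-descending k x []       lt _  _ rewrite <⇒<ᵇ′ lt = refl
  insert-descending k x (y ∷ ys) lt x∉ d with key y <ᵇ key x in yx
  ... | true rewrite <⇒<ᵇ′ lt | yx = proj₂ (∧-true⁻ _ _ d)
  ... | false =
    let (h₁ , h₂) = ∧-true⁻ _ _ d in
    subst (λ z → (z ∧ descending (key y ∷ map key (insert x ys))) ≡ true) (sym h₁)
      (insert-descending (key y) x ys x<y (λ m → x∉ (there m)) h₂)
    where
    x<y : key x < key y
    x<y with <-cmp (key x) (key y)
    ... | tri< a _ _ = a
    ... | tri≈ _ e _ = ⊥-elim (x∉ (here (key-injective x y e)))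
    ... | tri> _ _ c = case trans (sym (<⇒<ᵇ′ c)) yx of λ ()

  sort-descending : ∀ k → (∀ x → key x < k) → ∀ xs → Nodup xs →
    descending (k ∷ map key (sort xs)) ≡ true
  sort-descending k below []       _         = refl
  sort-descending k below (x ∷ xs) (x∉ , nd) =
    insert-descending k x (sort xs) (below x) (λ m → x∉ (∈-sort⁻ xs x m))
      (sort-descending k below xs nd)

  descending⇒Nodup : ∀ xs → descending (map key xs) ≡ true → Nodup xs
  descending⇒Nodup []       _ = tt
  descending⇒Nodup (x ∷ xs) d =
    (λ m → <-irrefl refl (descending-below (key x) (map key xs) d (key x) (∈-map⁺ key m))) ,
    descending⇒Nodup xs (descending-tail (key x) (map key xs) d)

  map-key-injective : ∀ xs ys → map key xs ≡ map key ys → xs ≡ ys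
  map-key-injective []       []       e = refl
  map-key-injective (x ∷ xs) (y ∷ ys) e =
    cong₂ _∷_ (key-injective x y (LP.∷-injectiveˡ e)) (map-key-injective xs ys (LP.∷-injectiveʳ e))

descentPattern : List (ℕ × ℕ) → List Bool
descentPattern (x ∷ y ∷ rest) = (y <col x) ∷ descentPattern (y ∷ rest)
descentPattern _              = []

length-descentPattern : ∀ x xs → length (descentPattern (x ∷ xs)) ≡ length xs
length-descentPattern x []       = refl
length-descentPattern x (y ∷ xs) = cong suc (length-descentPattern y xs)

length-desList : ∀ i xs → length (desList i xs) ≡ patternDes (descentPattern xs)
length-desList i []             = refl
length-desList i (x ∷ [])       = refl
length-desList i (x ∷ y ∷ rest) =
  trans (length-if (y <col x)) (cong (ind (y <col x) +_) (length-desList (suc i) (y ∷ rest)))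
  where
  length-if : ∀ c {L : List ℕ} → length (if c then i ∷ L else L) ≡ ind c + length L
  length-if true  = refl
  length-if false = refl

sum-desList : ∀ i xs → sum (desList i xs) ≡ patternMaj i (descentPattern xs)
sum-desList i []             = refl
sum-desList i (x ∷ [])       = refl
sum-desList i (x ∷ y ∷ rest) =
  trans (sum-if (y <col x)) (cong ((if y <col x then i else 0) +_) (sum-desList (suc i) (y ∷ rest)))
  where
  sum-if : ∀ c {L : List ℕ} → sum (if c then i ∷ L else L) ≡ (if c then i else 0) + sum L
  sum-if true  = refl
  sum-if false = refl

-- A coloured letter is below every uncoloured one, so a non-descent cannot go from an
-- uncoloured letter to a coloured one.
non-descent-colour : ∀ (e e′ : ℕ × ℕ) → (e′ <col e) ≡ false → 0 < proj₂ e′ → 0 < proj₂ e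
non-descent-colour (a , suc c) e′           _  _ = s≤s z≤n
non-descent-colour (a , zero)  (a′ , suc c′) () _
non-descent-colour (a , zero)  (a′ , zero)   _  ()

BelowLevel : ℕ → ℕ × ℕ → ℕ → Set
BelowLevel b e h = h ≤ b × (0 < proj₂ e → h < b)

chain-belowLevel : ∀ b e es y hs → BelowLevel b e y →
  isChain (descentPattern (e ∷ es)) y hs ≡ true → Pointwise (BelowLevel b) es hs
chain-belowLevel b e []        y []       _              _  = []
chain-belowLevel b e (e′ ∷ es) y (h ∷ hs) (y≤b , y<b) ch =
  let (s , rest) = ∧-true⁻ (follows (e′ <col e) y h) _ ch
      h≤b        = ≤-trans (follows⇒≤ (e′ <col e) y h s) y≤b
      below      = h≤b , strict s
  in below ∷ chain-belowLevel b e′ es h hs below rest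
  where
  strict : follows (e′ <col e) y h ≡ true → 0 < proj₂ e′ → h < b
  strict s c′>0 with e′ <col e in lt
  ... | true  = <-≤-trans (<ᵇ⇒<′ h y s) y≤b
  ... | false = ≤-<-trans (≤ᵇ⇒≤′ h y s) (y<b (non-descent-colour e e′ lt c′>0))

m'-low : ∀ x b → x ≤ b → m' x b ≡ (x , 0)
m'-low x b le rewrite ≤⇒≤ᵇ′ le = refl

m'-high : ∀ x b → b < x → x ≤ b + b → m' x b ≡ (x ∸ suc b , 1)
m'-high x       zero    lt le = ⊥-elim (<⇒≱ lt le)
m'-high (suc x) (suc k) lt le rewrite ≰⇒≤ᵇ-false {suc x} {suc k} (<⇒≱ lt) = cong₂ _,_ rem quot
  where
  k<x : suc k ≤ x
  k<x = ≤-pred lt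
  small : x ∸ suc k < suc k
  small = m<n+o⇒m∸n<o x (suc k) le
  rem : x % suc k ≡ x ∸ suc k
  rem = trans (cong (_% suc k) (sym (m∸n+n≡m k<x)))
              (trans ([m+n]%n≡m%n (x ∸ suc k) (suc k)) (m<n⇒m%n≡m small))
  quot : x / suc k ≡ 1
  quot = trans (m/n≡1+[m∸n]/n k<x) (cong suc (m<n⇒m/n≡0 small))

b+b : ∀ b → b * 2 ≡ b + b
b+b b = trans (*-comm b 2) (cong (b +_) (+-identityʳ b))

module AtLevel (r n l : ℕ) (ε : Vec (Fin r) n)
               (hε : ∀ i → toℕ (lookup ε i) ≡ (if toℕ i <ᵇ l then 1 else 0)) (b : ℕ) where

  coloured : Fin n → Bool
  coloured p = toℕ p <ᵇ l

  Admissible : Fin n → ℕ → Set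
  Admissible p x = if coloured p then (b < x × x ≤ b + b) else x ≤ b

  coordOK : ∀ {r} → Fin r → ℕ → ℕ → Bool
  coordOK e x k = (k * toℕ e ≤ᵇ x) ∧ (x ≤ᵇ k * (toℕ e + 1)) ∧ ((toℕ e ≡ᵇ 0) ∨ (k * toℕ e <ᵇ x))

  coordOK⇒Admissible : ∀ p x → coordOK (lookup ε p) x b ≡ true → Admissible p x
  coordOK⇒Admissible p x h with coloured p in cp | hε p
  ... | true  | e rewrite e | *-identityʳ b =
    let (h₁ , h₂₃) = ∧-true⁻ (b ≤ᵇ x) _ h ; (h₂ , h₃) = ∧-true⁻ (x ≤ᵇ b * 2) _ h₂₃ in
    <ᵇ⇒<′ b x h₃ , subst (x ≤_) (b+b b) (≤ᵇ⇒≤′ x (b * 2) h₂)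
  ... | false | e rewrite e | *-identityʳ b | *-zeroʳ b = ≤ᵇ⇒≤′ x b (proj₁ (∧-true⁻ (x ≤ᵇ b) _ h))

  Admissible⇒coordOK : ∀ p x → Admissible p x → coordOK (lookup ε p) x b ≡ true
  Admissible⇒coordOK p x g with coloured p in cp | hε p
  Admissible⇒coordOK p x (lt , le) | true | e rewrite e | *-identityʳ b
    | ≤⇒≤ᵇ′ (<⇒≤ lt) | <⇒<ᵇ′ lt | ≤⇒≤ᵇ′ {x} {b * 2} (subst (x ≤_) (sym (b+b b)) le) = refl
  Admissible⇒coordOK p x le | false | e rewrite e | *-identityʳ b | *-zeroʳ b | ≤⇒≤ᵇ′ le = refl

  InL : Vec ℕ n → Set
  InL v = ∀ p → Admissible p (lookup v p)

  inL⇒coordOK : ∀ {m} (ε′ : Vec (Fin r) m) (v : Vec ℕ m) → inL ε′ v b ≡ true →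
    ∀ p → coordOK (lookup ε′ p) (lookup v p) b ≡ true
  inL⇒coordOK (e ∷ ε′) (x ∷ v) h zero    with coordOK e x b | h
  ... | true | _  = refl
  inL⇒coordOK (e ∷ ε′) (x ∷ v) h (suc p) with coordOK e x b | h
  ... | true | h′ = inL⇒coordOK ε′ v h′ p

  coordOK⇒inL : ∀ {m} (ε′ : Vec (Fin r) m) (v : Vec ℕ m) →
    (∀ p → coordOK (lookup ε′ p) (lookup v p) b ≡ true) → inL ε′ v b ≡ true
  coordOK⇒inL []       []      h = refl
  coordOK⇒inL (e ∷ ε′) (x ∷ v) h rewrite h zero = coordOK⇒inL ε′ v (λ p → h (suc p))

  inL⇒InL : ∀ v → inL ε v b ≡ true → InL v
  inL⇒InL v h p = coordOK⇒Admissible p (lookup v p) (inL⇒coordOK ε v h p)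

  InL⇒inL : ∀ v → InL v → inL ε v b ≡ true
  InL⇒inL v g = coordOK⇒inL ε v (λ p → Admissible⇒coordOK p (lookup v p) (g p))

  reduce : Fin n → ℕ → ℕ
  reduce p x = if coloured p then x ∸ suc b else x

  unreduce : Fin n → ℕ → ℕ
  unreduce p y = if coloured p then y + suc b else y

  reduce-unreduce : ∀ p y → reduce p (unreduce p y) ≡ y
  reduce-unreduce p y with coloured p
  ... | true  = m+n∸n≡m y (suc b)
  ... | false = refl

  unreduce-reduce : ∀ p x → Admissible p x → unreduce p (reduce p x) ≡ x
  unreduce-reduce p x g with coloured p
  ... | true  = m∸n+n≡m (proj₁ g)
  ... | false = refl

  reduce≤ : ∀ p x → Admissible p x → reduce p x ≤ b
  reduce≤ p x g with coloured p
  ... | true  = ≤-trans (∸-monoˡ-≤ (suc b) (proj₂ g))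
                        (≤-trans (∸-monoʳ-≤ (b + b) (n≤1+n b)) (≤-reflexive (m+n∸n≡m b b)))
  ... | false = g

  reduce<-coloured : ∀ p x → coloured p ≡ true → Admissible p x → reduce p x < b
  reduce<-coloured p x c g rewrite c =
    subst (x ∸ suc b <_) (m+n∸m≡n (suc b) b) (∸-monoˡ-< (s≤s (proj₂ g)) (proj₁ g))

  Admissible-unreduce : ∀ p y → y ≤ b → (coloured p ≡ true → y < b) → Admissible p (unreduce p y)
  Admissible-unreduce p y le lt with coloured p
  ... | true  = m≤n+m (suc b) y , subst (_≤ b + b) (sym (+-suc y b)) (+-monoˡ-≤ b (lt refl))
  ... | false = le

  Admissible≤ : 1 ≤ r → (0 < l → 2 ≤ r) → ∀ p x → Admissible p x → x ≤ b * r
  Admissible≤ r≥1 r≥2 p x g with coloured p in e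
  ... | true  = ≤-trans (proj₂ g) (subst (_≤ b * r) (b+b b)
                  (*-monoʳ-≤ b (r≥2 (≤-<-trans z≤n (<ᵇ⇒<′ (toℕ p) l e)))))
  ... | false = ≤-trans g (subst (_≤ b * r) (*-identityʳ b) (*-monoʳ-≤ b r≥1))

  m'₁-Admissible : ∀ p x → Admissible p x → proj₁ (m' x b) ≡ reduce p x
  m'₁-Admissible p x g with coloured p
  ... | true  = cong proj₁ (m'-high x b (proj₁ g) (proj₂ g))
  ... | false = cong proj₁ (m'-low x b g)

  m'₂-Admissible : ∀ p x → Admissible p x → proj₂ (m' x b) ≡ ind (coloured p)
  m'₂-Admissible p x g with coloured p
  ... | true  = cong proj₂ (m'-high x b (proj₁ g) (proj₂ g))
  ... | false = cong proj₂ (m'-low x b g)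

  mq-reduce : ∀ v → InL v → mq v b ≡ sumFin (λ p → reduce p (lookup v p))
  mq-reduce v g = trans (sum-map _ (toList v))
    (trans (sumL-toList _ v) (sumFin-cong (λ p → m'₁-Admissible p _ (g p))))

  mu-l : l ≤ n → ∀ v → InL v → mu v b ≡ l
  mu-l l≤n v g = trans (sum-map _ (toList v)) (trans (sumL-toList _ v)
    (trans (sumFin-cong (λ p → m'₂-Admissible p _ (g p))) (sumFin-initial n l l≤n)))

  letter : Fin n → ℕ × ℕ
  letter p = (suc (toℕ p) , toℕ (lookup ε p))

  windowPattern : Vec (Fin n) n → List Bool
  windowPattern w = descentPattern ((0 , 0) ∷ map letter (toList w))

  length-windowPattern : ∀ w → length (windowPattern w) ≡ n
  length-windowPattern w =
    trans (length-descentPattern (0 , 0) (map letter (toList w)))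
          (trans (LP.length-map letter (toList w)) (VP.length-toList w))

  des-windowPattern : ∀ w → des ε w ≡ patternDes (windowPattern w)
  des-windowPattern w = length-desList 0 ((0 , 0) ∷ map letter (toList w))

  maj-windowPattern : ∀ w → maj ε w ≡ patternMaj 0 (windowPattern w)
  maj-windowPattern w = sum-desList 0 ((0 , 0) ∷ map letter (toList w))

  Pointwise-lookup : ∀ {m} {P : ℕ × ℕ → ℕ → Set} (w : Vec (Fin n) m) (h : Vec ℕ m) →
    Pointwise P (map letter (toList w)) (toList h) → ∀ i → P (letter (lookup w i)) (lookup h i)
  Pointwise-lookup (p ∷ w) (x ∷ h) (z ∷ _)  zero    = z
  Pointwise-lookup (p ∷ w) (x ∷ h) (_ ∷ zs) (suc i) = Pointwise-lookup w h zs i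

  chain-window-bounds : ∀ w (h : Vec ℕ n) → isChain (windowPattern w) b (toList h) ≡ true →
    ∀ i → lookup h i ≤ b × (coloured (lookup w i) ≡ true → lookup h i < b)
  chain-window-bounds w h ch i =
    let (≤b , <b) = Pointwise-lookup w h
                      (chain-belowLevel b (0 , 0) (map letter (toList w)) b (toList h) (≤-refl , λ ()) ch) i
    in ≤b , λ c → <b (colour-positive (lookup w i) c)
    where
    colour-positive : ∀ p → coloured p ≡ true → 0 < proj₂ (letter p)
    colour-positive p c rewrite hε p | c = s≤s z≤n

  pointBox : List (Vec ℕ n)
  pointBox = allVecs (upTo (suc (b * r))) n

  chainBox : List (Vec ℕ n)
  chainBox = allVecs (upTo (suc b)) n

  isPoint : ℕ → Vec ℕ n → Bool
  isPoint a v = inL ε v b ∧ (mq v b ≡ᵇ a)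

  compatibleWith : Vec ℕ n → Vec (Fin n) n → Bool
  compatibleWith v w = isChain (windowPattern w) b (map (λ p → reduce p (lookup v p)) (toList w))

  module ReadAlong (w : Vec (Fin n) n) (isPerm-w : isPerm w ≡ true) where
    open Window w isPerm-w

    readAlong : Vec ℕ n → Vec ℕ n
    readAlong v = V.map (λ p → reduce p (lookup v p)) w

    writeAlong : Vec ℕ n → Vec ℕ n
    writeAlong h = tabulate (λ p → unreduce p (lookup h (inv p)))

    toList-readAlong : ∀ v → toList (readAlong v) ≡ map (λ p → reduce p (lookup v p)) (toList w)
    toList-readAlong v = VP.toList-map _ w

    read∘write : ∀ h → readAlong (writeAlong h) ≡ h
    read∘write h = lookup-ext _ _ λ i → begin
      lookup (readAlong (writeAlong h)) i
        ≡⟨ VP.lookup-map i _ w ⟩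
      reduce (lookup w i) (lookup (writeAlong h) (lookup w i))
        ≡⟨ cong (reduce (lookup w i)) (VP.lookup∘tabulate _ (lookup w i)) ⟩
      reduce (lookup w i) (unreduce (lookup w i) (lookup h (inv (lookup w i))))
        ≡⟨ reduce-unreduce _ _ ⟩
      lookup h (inv (lookup w i))
        ≡⟨ cong (lookup h) (inv-lookup i) ⟩
      lookup h i ∎
      where open ≡-Reasoning

    write∘read : ∀ v → InL v → writeAlong (readAlong v) ≡ v
    write∘read v g = lookup-ext _ _ λ p → begin
      lookup (writeAlong (readAlong v)) p
        ≡⟨ VP.lookup∘tabulate _ p ⟩
      unreduce p (lookup (readAlong v) (inv p))
        ≡⟨ cong (unreduce p) (VP.lookup-map (inv p) _ w) ⟩
      unreduce p (reduce (lookup w (inv p)) (lookup v (lookup w (inv p))))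
        ≡⟨ cong (λ q → unreduce p (reduce q (lookup v q))) (lookup-inv p) ⟩
      unreduce p (reduce p (lookup v p))
        ≡⟨ unreduce-reduce p _ (g p) ⟩
      lookup v p ∎
      where open ≡-Reasoning

    sum-readAlong : ∀ v → InL v → sum (toList (readAlong v)) ≡ mq v b
    sum-readAlong v g = trans (cong sum (toList-readAlong v))
      (trans (sum-map _ (toList w)) (trans (sumL-window _) (sym (mq-reduce v g))))

    InL-writeAlong : ∀ h → isChain (windowPattern w) b (toList h) ≡ true → InL (writeAlong h)
    InL-writeAlong h ch p = subst (Admissible p) (sym (VP.lookup∘tabulate _ p))
      (Admissible-unreduce p _ (proj₁ (chain-window-bounds w h ch (inv p)))
        (λ c → proj₂ (chain-window-bounds w h ch (inv p)) (trans (cong coloured (lookup-inv p)) c)))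

    mq-writeAlong : ∀ h → isChain (windowPattern w) b (toList h) ≡ true →
      mq (writeAlong h) b ≡ sum (toList h)
    mq-writeAlong h ch = begin
      mq (writeAlong h) b
        ≡⟨ mq-reduce (writeAlong h) (InL-writeAlong h ch) ⟩
      sumFin (λ p → reduce p (lookup (writeAlong h) p))
        ≡⟨ sumFin-cong (λ p → trans (cong (reduce p) (VP.lookup∘tabulate _ p)) (reduce-unreduce p _)) ⟩
      sumFin (λ p → lookup h (inv p))
        ≡⟨ sym (sumL-window (λ p → lookup h (inv p))) ⟩
      sumL (λ p → lookup h (inv p)) (toList w)
        ≡⟨ sumL-toList _ w ⟩
      sumFin (λ i → lookup h (inv (lookup w i)))
        ≡⟨ sumFin-cong (λ i → cong (lookup h) (inv-lookup i)) ⟩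
      sumFin (lookup h)
        ≡⟨ sym (sumL-toList (λ x → x) h) ⟩
      sumL (λ x → x) (toList h)
        ≡⟨ sym (trans (cong sum (sym (LP.map-id (toList h)))) (sum-map (λ x → x) (toList h))) ⟩
      sum (toList h) ∎
      where open ≡-Reasoning

    pointTest : ℕ → Vec ℕ n → Bool
    pointTest a v = isPoint a v ∧ compatibleWith v w

    chainTest : ℕ → Vec ℕ n → Bool
    chainTest a h = isChain (windowPattern w) b (toList h) ∧ (sum (toList h) ≡ᵇ a)

    read-maps : ∀ a v → pointTest a v ≡ true →
      (readAlong v ∈ chainBox) × (chainTest a (readAlong v) ≡ true) × (writeAlong (readAlong v) ≡ v)
    read-maps a v test =
      let (inL×mq , comp) = ∧-true⁻ _ _ test ; (inLv , mq≡a) = ∧-true⁻ _ _ inL×mq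
          g = inL⇒InL v inLv
      in ∈-allVecs _ n (readAlong v)
           (λ i → ∈-upTo-suc (subst (_≤ b) (sym (VP.lookup-map i _ w)) (reduce≤ _ _ (g (lookup w i))))) ,
         subst₂ (λ hs s → (isChain (windowPattern w) b hs ∧ (s ≡ᵇ a)) ≡ true)
                (sym (toList-readAlong v)) (sym (trans (sum-readAlong v g) (≡ᵇ⇒≡′ _ _ mq≡a)))
                (subst (λ z → (z ∧ (a ≡ᵇ a)) ≡ true) (sym comp) (≡ᵇ-refl a)) ,
         write∘read v g

    write-maps : 1 ≤ r → (0 < l → 2 ≤ r) → ∀ a h → chainTest a h ≡ true →
      (writeAlong h ∈ pointBox) × (pointTest a (writeAlong h) ≡ true) × (readAlong (writeAlong h) ≡ h)
    write-maps r≥1 r≥2 a h test =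
      let (ch , sum≡a) = ∧-true⁻ _ _ test
          g = InL-writeAlong h ch
          comp : compatibleWith (writeAlong h) w ≡ true
          comp = subst (λ z → isChain (windowPattern w) b z ≡ true)
                       (sym (trans (sym (toList-readAlong (writeAlong h))) (cong toList (read∘write h)))) ch
      in ∈-allVecs _ n (writeAlong h) (λ p → ∈-upTo-suc (Admissible≤ r≥1 r≥2 p _ (g p))) ,
         subst₂ (λ t m → ((t ∧ (m ≡ᵇ a)) ∧ compatibleWith (writeAlong h) w) ≡ true)
                (sym (InL⇒inL _ g)) (sym (trans (mq-writeAlong h ch) (≡ᵇ⇒≡′ _ _ sum≡a)))
                (subst (λ z → ((true ∧ z) ∧ compatibleWith (writeAlong h) w) ≡ true) (sym (≡ᵇ-refl a)) comp) ,
         read∘write h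

    count-compatible : 1 ≤ r → (0 < l → 2 ≤ r) → ∀ a →
      count (pointTest a) pointBox ≡ count (chainTest a) chainBox
    count-compatible r≥1 r≥2 a =
      count-bijection (VP.≡-dec Data.Nat._≟_) (VP.≡-dec Data.Nat._≟_) (pointTest a) (chainTest a)
        readAlong writeAlong pointBox chainBox
        (Nodup-allVecs _ n (Nodup-upTo _)) (Nodup-allVecs _ n (Nodup-upTo _))
        (λ v _ → read-maps a v) (λ h _ → write-maps r≥1 r≥2 a h)

  -- The order _<col_ on the letters of G_ε, encoded by ranks: coloured letters (p < l) get
  -- the ranks below l in reverse order, the letter 0^0 gets rank l, uncoloured letters
  -- the ranks above l in order.
  rankBound : ℕ
  rankBound = suc (n + l)

  rank : Fin n → ℕ
  rank p = if coloured p then l ∸ suc (toℕ p) else suc (toℕ p) + l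

  rank< : ∀ p → rank p < rankBound
  rank< p with coloured p
  ... | true  = s≤s (≤-trans (m∸n≤m l (suc (toℕ p))) (m≤n+m l n))
  ... | false = s≤s (+-monoˡ-≤ l (toℕ<n p))

  l<rankBound : l < rankBound
  l<rankBound = s≤s (m≤n+m l n)

  rank<l : ∀ p → coloured p ≡ true → l ∸ suc (toℕ p) < l
  rank<l p c = ∸-monoʳ-< {l} {suc (toℕ p)} {0} (s≤s z≤n) (<ᵇ⇒<′ (toℕ p) l c)

  rank-unc : ∀ p → coloured p ≡ false → rank p ≡ suc (toℕ p) + l
  rank-unc p c rewrite c = refl

  letter-order : ∀ p q → (letter q <col letter p) ≡ (rank q <ᵇ rank p)
  letter-order p q with coloured p in cp | coloured q in cq
  ... | true | true rewrite hε p | hε q | cp | cq | ∨-identityʳ (suc (toℕ p) <ᵇ suc (toℕ q)) =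
    bool-ext (λ h → <⇒<ᵇ′ (∸-monoʳ-< (s≤s (<ᵇ⇒<′ _ _ h)) (<ᵇ⇒<′ (toℕ q) l cq))) reversed
    where
    reversed : (l ∸ suc (toℕ q) <ᵇ l ∸ suc (toℕ p)) ≡ true → (suc (toℕ p) <ᵇ suc (toℕ q)) ≡ true
    reversed h with <-cmp (toℕ p) (toℕ q)
    ... | tri< a _ _ = <⇒<ᵇ′ (s≤s a)
    ... | tri≈ _ e _ = ⊥-elim (<-irrefl (cong (λ z → l ∸ suc z) (sym e)) (<ᵇ⇒<′ _ _ h))
    ... | tri> _ _ c = ⊥-elim (<-asym (<ᵇ⇒<′ _ _ h) (∸-monoʳ-< (s≤s c) (<ᵇ⇒<′ (toℕ p) l cp)))
  ... | true | false rewrite hε p | hε q | cp | cq =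
    sym (≮⇒<ᵇ-false (λ lt → <-irrefl refl
      (<-≤-trans (rank<l p cp) (≤-trans (m≤n+m l (suc (toℕ q))) (<⇒≤ lt)))))
  ... | false | true rewrite hε p | hε q | cp | cq =
    sym (<⇒<ᵇ′ (<-≤-trans (rank<l q cq) (m≤n+m l (suc (toℕ p)))))
  ... | false | false rewrite hε p | hε q | cp | cq = trans (∨-identityʳ _)
    (bool-ext (λ h → <⇒<ᵇ′ (+-monoˡ-< l (<ᵇ⇒<′ (toℕ q) (toℕ p) h)))
              (λ h → <⇒<ᵇ′ (+-cancelʳ-< l (toℕ q) (toℕ p) (<ᵇ⇒<′ (toℕ q + l) (toℕ p + l) h))))

  letter-order₀ : ∀ q → (letter q <col (0 , 0)) ≡ (rank q <ᵇ l)
  letter-order₀ q with coloured q in cq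
  ... | true  rewrite hε q | cq = sym (<⇒<ᵇ′ (rank<l q cq))
  ... | false rewrite hε q | cq =
    sym (≮⇒<ᵇ-false (λ lt → <-irrefl refl (<-trans lt (s≤s (m≤n+m l (toℕ q))))))

  rank-injective : ∀ p q → p ≢ q → rank p ≢ rank q
  rank-injective p q p≢q e with coloured p in cp | coloured q in cq
  ... | true  | true  = p≢q (toℕ-injective (suc-injective
        (trans (sym (m∸[m∸n]≡n (<ᵇ⇒<′ (toℕ p) l cp)))
               (trans (cong (l ∸_) e) (m∸[m∸n]≡n (<ᵇ⇒<′ (toℕ q) l cq))))))
  ... | true  | false = <-irrefl e (<-≤-trans (rank<l p cp) (m≤n+m l (suc (toℕ q))))
  ... | false | true  = <-irrefl (sym e) (<-≤-trans (rank<l q cq) (m≤n+m l (suc (toℕ p))))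
  ... | false | false = p≢q (toℕ-injective (suc-injective (+-cancelʳ-≡ l _ _ e)))

  rank≢l : ∀ q → l ≢ rank q
  rank≢l q e with coloured q in cq
  ... | true  = <-irrefl (sym e) (rank<l q cq)
  ... | false = <-irrefl e (s≤s (m≤n+m l (toℕ q)))

  module Sorting (v : Vec ℕ n) (admissible : InL v) where

    value : Fin n → ℕ
    value p = reduce p (lookup v p)

    key : Fin n → ℕ
    key p = lexKey rankBound (rank p) (value p)

    topKey : ℕ
    topKey = lexKey rankBound l b

    follows-key : ∀ p q → p ≢ q →
      follows (letter q <col letter p) (value p) (value q) ≡ (key q <ᵇ key p)
    follows-key p q p≢q rewrite letter-order p q =
      follows-lexKey rankBound (rank p) (rank q) (value p) (value q) (rank< p) (rank< q)
                     (rank-injective p q p≢q)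

    follows-key₀ : ∀ q → follows (letter q <col (0 , 0)) b (value q) ≡ (key q <ᵇ topKey)
    follows-key₀ q rewrite letter-order₀ q =
      follows-lexKey rankBound l (rank q) b (value q) l<rankBound (rank< q) (rank≢l q)

    key-injective : ∀ p q → key p ≡ key q → p ≡ q
    key-injective p q e with p Data.Fin.≟ q
    ... | yes p≡q = p≡q
    ... | no  p≢q = ⊥-elim (rank-injective p q p≢q
          (revRank-injective rankBound _ _ (rank< p) (rank< q)
            (lex-≡⁻ rankBound (value q) (value p) _ _
              (revRank< rankBound _ (rank< q)) (revRank< rankBound _ (rank< p)) e)))

    -- Every key is below the top key: values are ≤ b, and a value equal to b is uncoloured,
    -- hence of rank above l.
    key<topKey : ∀ p → key p < topKey
    key<topKey p with m≤n⇒m<n∨m≡n (reduce≤ p _ (admissible p))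
    ... | inj₁ lt = lex-< rankBound b (value p) _ _ (revRank< rankBound _ (rank< p)) lt
    ... | inj₂ e  = atTop (coloured p) refl
      where
      atTop : ∀ t → coloured p ≡ t → key p < topKey
      atTop true  cp = ⊥-elim (<-irrefl e (reduce<-coloured p _ cp (admissible p)))
      atTop false cp = subst (λ z → z * rankBound + revRank rankBound (rank p) < topKey) (sym e)
        (+-monoʳ-< (b * rankBound) (revRank-anti rankBound l (rank p) (rank< p)
          (subst (l <_) (sym (rank-unc p cp)) (s≤s (m≤n+m l (toℕ p))))))

    chain⇔descending : ∀ (ps : List (Fin n)) q → Nodup (q ∷ ps) →
      isChain (descentPattern (letter q ∷ map letter ps)) (value q) (map value ps)
      ≡ descending (key q ∷ map key ps)
    chain⇔descending []       q _         = refl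
    chain⇔descending (p ∷ ps) q (q∉ , nd)
      rewrite follows-key q p (λ e → q∉ (here e)) | chain⇔descending ps p nd = refl

    chain⇔descending₀ : ∀ (ps : List (Fin n)) → Nodup ps →
      isChain (descentPattern ((0 , 0) ∷ map letter ps)) b (map value ps)
      ≡ descending (topKey ∷ map key ps)
    chain⇔descending₀ []       _  = refl
    chain⇔descending₀ (p ∷ ps) nd rewrite follows-key₀ p | chain⇔descending ps p nd = refl

    open SortByKey key key-injective

    sortedPositions : List (Fin n)
    sortedPositions = sort (L.allFin n)

    sortingPermutation : Vec (Fin n) n
    sortingPermutation = V.cast length-sorted (V.fromList sortedPositions)
      where
      length-sorted : length sortedPositions ≡ n
      length-sorted = trans (length-sort (L.allFin n)) (LP.length-tabulate (λ i → i))

    toList-sortingPermutation : toList sortingPermutation ≡ sortedPositions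
    toList-sortingPermutation = trans (VP.toList-cast _ _) (VP.toList∘fromList sortedPositions)

    sorted-descending : descending (topKey ∷ map key sortedPositions) ≡ true
    sorted-descending = sort-descending topKey key<topKey (L.allFin n) (Nodup-allFin n)

    sorted-nodup : Nodup (toList sortingPermutation)
    sorted-nodup = subst Nodup (sym toList-sortingPermutation)
      (descending⇒Nodup sortedPositions (descending-tail topKey (map key sortedPositions) sorted-descending))

    sortingPermutation-works : (isPerm sortingPermutation ∧ compatibleWith v sortingPermutation) ≡ true
    sortingPermutation-works rewrite Nodup⇒distinctᵇ (toList sortingPermutation) sorted-nodup =
      trans (chain⇔descending₀ (toList sortingPermutation) sorted-nodup)
            (subst (λ z → descending (topKey ∷ map key z) ≡ true) (sym toList-sortingPermutation)
                   sorted-descending)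

    -- Any compatible permutation lists the positions by decreasing key, so it is the sorted one.
    compatible-unique : ∀ w → (isPerm w ∧ compatibleWith v w) ≡ true → w ≡ sortingPermutation
    compatible-unique w h =
      trans (sym (VP.cast-is-id refl w))
            (VP.toList-injective refl w sortingPermutation (trans same (sym toList-sortingPermutation)))
      where
      isPerm-w = proj₁ (∧-true⁻ _ _ h)
      open Window w isPerm-w using (nodup; ∈-window)
      keys-descending : descending (topKey ∷ map key (toList w)) ≡ true
      keys-descending = trans (sym (chain⇔descending₀ (toList w) nodup)) (proj₂ (∧-true⁻ _ _ h))
      same : toList w ≡ sortedPositions
      same = map-key-injective (toList w) sortedPositions
        (descending-unique (map key (toList w)) (map key sortedPositions)
          (descending-tail topKey (map key (toList w)) keys-descending)
          (descending-tail topKey (map key sortedPositions) sorted-descending)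
          (λ z m → let (p , _ , e) = ∈-map⁻ key m in
                   subst (_∈ map key sortedPositions) (sym e) (∈-map⁺ key (∈-sort⁺ (L.allFin n) p (∈-allFin p))))
          (λ z m → let (p , _ , e) = ∈-map⁻ key m in
                   subst (_∈ map key (toList w)) (sym e) (∈-map⁺ key (∈-window p))))

    count-compatible-permutations :
      count (λ w → isPerm w ∧ compatibleWith v w) (allVecs (L.allFin n) n) ≡ 1
    count-compatible-permutations =
      Removal.count-unique (VP.≡-dec (Data.Fin._≟_ {n})) _ (allVecs (L.allFin n) n) sortingPermutation
        (Nodup-allVecs _ n (Nodup-allFin n))
        (∈-allVecs _ n sortingPermutation (λ i → ∈-allFin _))
        sortingPermutation-works
        (λ w _ h → compatible-unique w h)

module Coefficients (r n l : ℕ) (ε : Vec (Fin r) n)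
                    (hε : ∀ i → toℕ (lookup ε i) ≡ (if toℕ i <ᵇ l then 1 else 0)) (l≤n : l ≤ n) where

  permutations : List (Vec (Fin n) n)
  permutations = allVecs (L.allFin n) n

  col-ε : col ε ≡ l
  col-ε = trans (sum-map toℕ (toList ε))
          (trans (sumL-toList toℕ ε) (trans (sumFin-cong hε) (sumFin-initial n l l≤n)))

  permutationTerm : ℕ → ℕ → Vec (Fin n) n → ℕ
  permutationTerm a b w =
    cond (isPerm w) (cond (maj ε w ≤ᵇ a) (cond (des ε w ≤ᵇ b) (invCoeff n (a ∸ maj ε w) (b ∸ des ε w))))

  hasStats : ℕ → ℕ → Vec (Fin n) n → Bool
  hasStats i j w = isPerm w ∧ (maj ε w ≡ᵇ i) ∧ (des ε w ≡ᵇ j)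

  ind-∧-last : ∀ x y z t → ind (x ∧ y ∧ z ∧ t) ≡ cond t (ind (x ∧ y ∧ z))
  ind-∧-last false _     _     t = sym (cond-0 t)
  ind-∧-last true  false _     t = sym (cond-0 t)
  ind-∧-last true  true  false t = sym (cond-0 t)
  ind-∧-last true  true  true  t = refl

  -- All of G_ε has u-degree col(ε) = l.
  numerator-coefficient : ∀ i j c → numerator ε i j c ≡ cond (l ≡ᵇ c) (count (hasStats i j) permutations)
  numerator-coefficient i j c = begin
      numerator ε i j c
    ≡⟨ count-sumL _ permutations ⟩
      sumL (λ w → ind (isPerm w ∧ (maj ε w ≡ᵇ i) ∧ (des ε w ≡ᵇ j) ∧ (col ε ≡ᵇ c))) permutations
    ≡⟨ sumL-cong permutations (λ w →
         trans (cong (λ x → ind (isPerm w ∧ (maj ε w ≡ᵇ i) ∧ (des ε w ≡ᵇ j) ∧ (x ≡ᵇ c))) col-ε)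
               (ind-∧-last (isPerm w) (maj ε w ≡ᵇ i) (des ε w ≡ᵇ j) (l ≡ᵇ c))) ⟩
      sumL (λ w → cond (l ≡ᵇ c) (ind (hasStats i j w))) permutations
    ≡⟨ sumL-cond (l ≡ᵇ c) _ permutations ⟩
      cond (l ≡ᵇ c) (sumL (λ w → ind (hasStats i j w)) permutations)
    ≡⟨ cong (cond (l ≡ᵇ c)) (sym (count-sumL (hasStats i j) permutations)) ⟩
      cond (l ≡ᵇ c) (count (hasStats i j) permutations)
    ∎
    where open ≡-Reasoning

  convolution-at-permutation : ∀ a b w →
    sumTo a (λ i → sumTo b (λ j → ind (hasStats i j w) * invCoeff n (a ∸ i) (b ∸ j)))
    ≡ permutationTerm a b w
  convolution-at-permutation a b w with isPerm w
  ... | false = sumTo-zero a _ (λ i _ → sumTo-zero b _ (λ j _ → refl))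
  ... | true  =
    trans (sumTo-cong a (λ i _ → trans (sumTo-cong b (λ j _ → separate i j))
                                       (sym (cond-sumTo (i ≡ᵇ maj ε w) b _))))
    (trans (sumTo-cong a (λ i _ → cong (cond (i ≡ᵇ maj ε w)) (sumTo-delta b (des ε w) (X i))))
           (sumTo-delta a (maj ε w) (λ i → cond (des ε w ≤ᵇ b) (X i (des ε w)))))
    where
    X : ℕ → ℕ → ℕ
    X i j = invCoeff n (a ∸ i) (b ∸ j)
    separate : ∀ i j → ind ((maj ε w ≡ᵇ i) ∧ (des ε w ≡ᵇ j)) * X i j
                       ≡ cond (i ≡ᵇ maj ε w) (if j ≡ᵇ des ε w then X i j else 0)
    separate i j rewrite ≡ᵇ-sym i (maj ε w) | ≡ᵇ-sym j (des ε w) with maj ε w ≡ᵇ i | des ε w ≡ᵇ j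
    ... | true  | true  = +-identityʳ _
    ... | true  | false = refl
    ... | false | _     = refl

  product-coefficient : ∀ a b c →
    (numerator ε ⊛ invProd n) a b c ≡ cond (l ≡ᵇ c) (sumL (permutationTerm a b) permutations)
  product-coefficient a b c = begin
      sumTo a (λ i → sumTo b (λ j → sumTo c (λ k → numerator ε i j k * invProd n (a ∸ i) (b ∸ j) (c ∸ k))))
    ≡⟨ sumTo-cong a (λ i _ → sumTo-cong b (λ j _ →
         trans (sumTo-invProd-u n c (numerator ε i j) (a ∸ i) (b ∸ j))
               (trans (cong (_* X i j) (numerator-coefficient i j c)) (cond-*ˡ (l ≡ᵇ c) _ _)))) ⟩
      sumTo a (λ i → sumTo b (λ j → cond (l ≡ᵇ c) (count (hasStats i j) permutations * X i j)))
    ≡⟨ trans (sumTo-cong a (λ i _ → sym (cond-sumTo (l ≡ᵇ c) b _))) (sym (cond-sumTo (l ≡ᵇ c) a _)) ⟩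
      cond (l ≡ᵇ c) (sumTo a (λ i → sumTo b (λ j → count (hasStats i j) permutations * X i j)))
    ≡⟨ cong (cond (l ≡ᵇ c)) exchange ⟩
      cond (l ≡ᵇ c) (sumL (permutationTerm a b) permutations)
    ∎
    where
    open ≡-Reasoning
    X : ℕ → ℕ → ℕ
    X i j = invCoeff n (a ∸ i) (b ∸ j)
    exchange : sumTo a (λ i → sumTo b (λ j → count (hasStats i j) permutations * X i j))
               ≡ sumL (permutationTerm a b) permutations
    exchange = begin
        sumTo a (λ i → sumTo b (λ j → count (hasStats i j) permutations * X i j))
      ≡⟨ sumTo-cong a (λ i _ → sumTo-cong b (λ j _ →
           trans (cong (_* X i j) (count-sumL (hasStats i j) permutations)) (sumL-*ʳ _ permutations (X i j)))) ⟩
        sumTo a (λ i → sumTo b (λ j → sumL (λ w → ind (hasStats i j w) * X i j) permutations))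
      ≡⟨ trans (sumTo-cong a (λ i _ → sumTo-sumL b (λ j w → ind (hasStats i j w) * X i j) permutations))
               (sumTo-sumL a (λ i w → sumTo b (λ j → ind (hasStats i j w) * X i j)) permutations) ⟩
        sumL (λ w → sumTo a (λ i → sumTo b (λ j → ind (hasStats i j w) * X i j))) permutations
      ≡⟨ sumL-cong permutations (convolution-at-permutation a b) ⟩
        sumL (permutationTerm a b) permutations
      ∎

  -- Coefficient of q^a t^b u^c on the left-hand side: every point of L_ε has u-degree l.
  cone-points : ∀ a b c → coneSeries r ε a b c
    ≡ cond (l ≡ᵇ c) (count (AtLevel.isPoint r n l ε hε b a) (AtLevel.pointBox r n l ε hε b))
  cone-points a b c =
    trans (count-sumL _ pointBox)
    (trans (sumL-cong pointBox pointwise)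
    (trans (sumL-cond (l ≡ᵇ c) _ pointBox) (cong (cond (l ≡ᵇ c)) (sym (count-sumL (isPoint a) pointBox)))))
    where
    open AtLevel r n l ε hε b
    pointwise : ∀ v → ind (inL ε v b ∧ (mq v b ≡ᵇ a) ∧ (mu v b ≡ᵇ c)) ≡ cond (l ≡ᵇ c) (ind (isPoint a v))
    pointwise v with inL ε v b in e
    ... | false = sym (cond-0 (l ≡ᵇ c))
    ... | true rewrite mu-l l≤n v (inL⇒InL v e) with mq v b ≡ᵇ a
    ...   | true  = refl
    ...   | false = sym (cond-0 (l ≡ᵇ c))

  compatible-points : 1 ≤ r → (0 < l → 2 ≤ r) → ∀ a b w →
    cond (isPerm w) (count (λ v → AtLevel.isPoint r n l ε hε b a v ∧ AtLevel.compatibleWith r n l ε hε b v w)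
                           (AtLevel.pointBox r n l ε hε b))
    ≡ permutationTerm a b w
  compatible-points r≥1 r≥2 a b w with isPerm w in isPerm-w
  ... | false = refl
  ... | true  = begin
      count (ReadAlong.pointTest w isPerm-w a) pointBox
    ≡⟨ ReadAlong.count-compatible w isPerm-w r≥1 r≥2 a ⟩
      count (ReadAlong.chainTest w isPerm-w a) chainBox
    ≡⟨ count-chains-box ds n b a (length-windowPattern w) ⟩
      chainsBelow ds b a
    ≡⟨ chainsBelow-shift ds b a ⟩
      cond (patternMaj 0 ds ≤ᵇ a) (cond (patternDes ds ≤ᵇ b)
        (nonincCount (length ds) (a ∸ patternMaj 0 ds) (b ∸ patternDes ds)))
    ≡⟨ cong (λ m → cond (patternMaj 0 ds ≤ᵇ a) (cond (patternDes ds ≤ᵇ b)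
                     (nonincCount m (a ∸ patternMaj 0 ds) (b ∸ patternDes ds))))
            (length-windowPattern w) ⟩
      cond (patternMaj 0 ds ≤ᵇ a) (cond (patternDes ds ≤ᵇ b)
        (nonincCount n (a ∸ patternMaj 0 ds) (b ∸ patternDes ds)))
    ≡⟨ sym (subst₂ (λ M D → cond (M ≤ᵇ a) (cond (D ≤ᵇ b) (invCoeff n (a ∸ M) (b ∸ D)))
                          ≡ cond (patternMaj 0 ds ≤ᵇ a) (cond (patternDes ds ≤ᵇ b)
                              (nonincCount n (a ∸ patternMaj 0 ds) (b ∸ patternDes ds))))
                   (sym (maj-windowPattern w)) (sym (des-windowPattern w))
                   (cong (cond (patternMaj 0 ds ≤ᵇ a)) (cong (cond (patternDes ds ≤ᵇ b))
                     (invCoeff≡nonincCount n _ _)))) ⟩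
      cond (maj ε w ≤ᵇ a) (cond (des ε w ≤ᵇ b) (invCoeff n (a ∸ maj ε w) (b ∸ des ε w)))
    ∎
    where
    open ≡-Reasoning
    open AtLevel r n l ε hε b
    ds = windowPattern w

  -- Splitting the points by their unique compatible permutation.
  points-by-permutation : 1 ≤ r → (0 < l → 2 ≤ r) → ∀ a b →
    count (AtLevel.isPoint r n l ε hε b a) (AtLevel.pointBox r n l ε hε b)
    ≡ sumL (permutationTerm a b) permutations
  points-by-permutation r≥1 r≥2 a b = begin
      count (isPoint a) pointBox
    ≡⟨ count-sumL (isPoint a) pointBox ⟩
      sumL (λ v → ind (isPoint a v)) pointBox
    ≡⟨ sumL-cong pointBox spread ⟩
      sumL (λ v → sumL (λ w → ind (isPoint a v ∧ (isPerm w ∧ compatibleWith v w))) permutations) pointBox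
    ≡⟨ sumL-swap (λ v w → ind (isPoint a v ∧ (isPerm w ∧ compatibleWith v w))) pointBox permutations ⟩
      sumL (λ w → sumL (λ v → ind (isPoint a v ∧ (isPerm w ∧ compatibleWith v w))) pointBox) permutations
    ≡⟨ sumL-cong permutations gather ⟩
      sumL (λ w → cond (isPerm w) (count (λ v → isPoint a v ∧ compatibleWith v w) pointBox)) permutations
    ≡⟨ sumL-cong permutations (compatible-points r≥1 r≥2 a b) ⟩
      sumL (permutationTerm a b) permutations
    ∎
    where
    open ≡-Reasoning
    open AtLevel r n l ε hε b
    spread : ∀ v → ind (isPoint a v) ≡ sumL (λ w → ind (isPoint a v ∧ (isPerm w ∧ compatibleWith v w))) permutations
    spread v with isPoint a v in e
    ... | false = sym (sumL-zero permutations)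
    ... | true  = sym (trans (sym (count-sumL (λ w → isPerm w ∧ compatibleWith v w) permutations))
                             (Sorting.count-compatible-permutations v (inL⇒InL v (proj₁ (∧-true⁻ _ _ e)))))
    gather : ∀ w → sumL (λ v → ind (isPoint a v ∧ (isPerm w ∧ compatibleWith v w))) pointBox
                   ≡ cond (isPerm w) (count (λ v → isPoint a v ∧ compatibleWith v w) pointBox)
    gather w with isPerm w
    ... | true  = sym (count-sumL _ pointBox)
    ... | false = trans (sumL-cong pointBox (λ v → cong ind (∧-falseʳ (isPoint a v)))) (sumL-zero pointBox)

mainTheorem2 : (r n l : ℕ) → 1 ≤ r → 1 ≤ n → l ≤ n → (0 < l → 2 ≤ r) →
    (ε : Vec (Fin r) n) →
    (∀ i → toℕ (lookup ε i) ≡ (if toℕ i <ᵇ l then 1 else 0)) →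
    coneSeries r ε ≈ₛ (numerator ε ⊛ invProd n)
mainTheorem2 r n l r≥1 _ l≤n r≥2 ε hε a b c = begin
    coneSeries r ε a b c
  ≡⟨ cone-points a b c ⟩
    cond (l ≡ᵇ c) (count (AtLevel.isPoint r n l ε hε b a) (AtLevel.pointBox r n l ε hε b))
  ≡⟨ cong (cond (l ≡ᵇ c)) (points-by-permutation r≥1 r≥2 a b) ⟩
    cond (l ≡ᵇ c) (sumL (permutationTerm a b) permutations)
  ≡⟨ sym (product-coefficient a b c) ⟩
    (numerator ε ⊛ invProd n) a b c
  ∎
  where
  open ≡-Reasoning
  open Coefficients r n l ε hε l≤n
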